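{- For every $s$ and every formula $\varphi$ of $TI_s$: if $TI_s\vdash\varphi$, then $TI_s^*\vdash\bar\varphi^*$, where $\bar\varphi$ is the universal closure of $\varphi$.
   Context: $TI$ is a classical many-sorted theory with variables $x^n,y^n,\dots$ of each type $n\geqslant0$, constant $0$, function symbols $S,+,\cdot$ on type 0, predicates $=_n$ and $\in_n$ ($t\in_n\tau$ with $t$ of type $n$, $\tau$ of type $n+1$); terms of type $n\geqslant1$ are variables. Logic: classical with equality. Axioms: Peano axioms for $0,S,+,\cdot$; induction on type 0 for all formulas; comprehension $\exists x^{n+1}\forall z^n(z\in x\equiv\varphi(z))$ whenever the maximal type of free variables of $\varphi$ is $\leqslant n+1$ and $x^{n+1}$ is not free in $\varphi$; extensionality $\forall z^n(z\in x^{n+1}\equiv z\in y^{n+1})\supset x=y$. $TI_s$ is the fragment with types $\leqslant s$, and $TI_s^*$ is $TI_s$ without the extensionality axiom. Define formulas $x^n\approx_n y^n$: $x^0\approx_0y^0$ is $x=y$; $x^{n+1}\approx_{n+1}y^{n+1}$ is $(\forall z^n\in x)(\exists u^n\in y)(z\approx_nu)\wedge(\forall z^n\in y)(\exists u^n\in x)(z\approx_nu)$. For a formula $\varphi$ of $TI$, $\varphi^*$ is defined by: $(t=_n\tau)^*$ is $t\approx_n\tau$; $(t\in_n\tau)^*$ is $(\exists z^n\in\tau)(z\approx_nt)$; $\bot^*=\bot$; $(\psi\theta\chi)^*=\psi^*\theta\chi^*$ for $\theta\in\{\wedge,\vee,\supset\}$; $(Qx^n\psi)^*=Qx^n\psi^*$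 for $Q\in\{\forall,\exists\}$. -}

module Defs where

open import Data.Nat using (ℕ; zero; suc; _≤_; _≡ᵇ_; _⊔_; _≟_)
open import Data.Bool using (Bool; true; false; _∧_; _∨_; not; if_then_else_)
open import Data.List using (List; []; _∷_; _++_; foldr; filterᵇ)
open import Data.Product using (_×_; _,_)
open import Data.Sum using (_⊎_)
open import Data.Unit using (⊤)
open import Relation.Binary.PropositionalEquality using (_≡_; refl)
open import Relation.Nullary using (yes; no)

-- Syntax of TI (many-sorted, classical, with equality).
-- Variables are named: x^n_i is  var n i  (type n, index i).
-- Terms of type n ≥ 1 are variables only (enforced by the indexing).

data Term : ℕ → Set where
  var  : (n i : ℕ) → Term n
  `0   : Term 0
  `S   : Term 0 → Term 0
  _`+_ : Term 0 → Term 0 → Term 0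
  _`·_ : Term 0 → Term 0 → Term 0

infix  7 _`=_ _`∈_
infixr 6 _`∧_
infixr 5 _`∨_
infixr 4 _`⊃_

data Form : Set where
  _`=_ : {n : ℕ} → Term n → Term n → Form
  _`∈_ : {n : ℕ} → Term n → Term (suc n) → Form
  `⊥   : Form
  _`∧_ : Form → Form → Form
  _`∨_ : Form → Form → Form
  _`⊃_ : Form → Form → Form
  `∀   : (n i : ℕ) → Form → Form
  `∃   : (n i : ℕ) → Form → Form

`¬_ : Form → Form
`¬ φ = φ `⊃ `⊥

_`⇔_ : Form → Form → Form
φ `⇔ ψ = (φ `⊃ ψ) `∧ (ψ `⊃ φ)

`⊤ : Form
`⊤ = `⊥ `⊃ `⊥

sameVar : ℕ → ℕ → ℕ → ℕ → Bool
sameVar m j n i = (m ≡ᵇ n) ∧ (j ≡ᵇ i)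

occursT : {m : ℕ} → ℕ → ℕ → Term m → Bool
occursT {m} n i (var .m j) = sameVar m j n i
occursT n i `0 = false
occursT n i (`S t) = occursT n i t
occursT n i (t `+ u) = occursT n i t ∨ occursT n i u
occursT n i (t `· u) = occursT n i t ∨ occursT n i u

freeIn : ℕ → ℕ → Form → Bool
freeIn n i (t `= u) = occursT n i t ∨ occursT n i u
freeIn n i (t `∈ u) = occursT n i t ∨ occursT n i u
freeIn n i `⊥ = false
freeIn n i (φ `∧ ψ) = freeIn n i φ ∨ freeIn n i ψ
freeIn n i (φ `∨ ψ) = freeIn n i φ ∨ freeIn n i ψ
freeIn n i (φ `⊃ ψ) = freeIn n i φ ∨ freeIn n i ψ
freeIn n i (`∀ m j φ) = if sameVar m j n i then false else freeIn n i φ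
freeIn n i (`∃ m j φ) = if sameVar m j n i then false else freeIn n i φ

varsT : {m : ℕ} → Term m → List (ℕ × ℕ)
varsT {m} (var .m j) = (m , j) ∷ []
varsT `0 = []
varsT (`S t) = varsT t
varsT (t `+ u) = varsT t ++ varsT u
varsT (t `· u) = varsT t ++ varsT u

dropVar : ℕ → ℕ → List (ℕ × ℕ) → List (ℕ × ℕ)
dropVar m j = filterᵇ (λ { (n , i) → not (sameVar n i m j) })

fvs : Form → List (ℕ × ℕ)
fvs (t `= u) = varsT t ++ varsT u
fvs (t `∈ u) = varsT t ++ varsT u
fvs `⊥ = []
fvs (φ `∧ ψ) = fvs φ ++ fvs ψ
fvs (φ `∨ ψ) = fvs φ ++ fvs ψ
fvs (φ `⊃ ψ) = fvs φ ++ fvs ψ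
fvs (`∀ m j φ) = dropVar m j (fvs φ)
fvs (`∃ m j φ) = dropVar m j (fvs φ)

closure : Form → Form
closure φ = foldr (λ { (n , i) ψ → `∀ n i ψ }) φ (fvs φ)

substT : {n m : ℕ} → Term n → ℕ → Term m → Term m
substT {n} t i (var m j) with m ≟ n | j ≟ i
... | yes refl | yes _ = t
... | _ | _ = var m j
substT t i `0 = `0
substT t i (`S u) = `S (substT t i u)
substT t i (u `+ v) = substT t i u `+ substT t i v
substT t i (u `· v) = substT t i u `· substT t i v

-- subst t i φ : φ[t / x^n_i] (free occurrences only, no renaming)
subst : {n : ℕ} → Term n → ℕ → Form → Form
subst t i (u `= v) = substT t i u `= substT t i v
subst t i (u `∈ v) = substT t i u `∈ substT t i v
subst t i `⊥ = `⊥
subst t i (φ `∧ ψ) = subst t i φ `∧ subst t i ψ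
subst t i (φ `∨ ψ) = subst t i φ `∨ subst t i ψ
subst t i (φ `⊃ ψ) = subst t i φ `⊃ subst t i ψ
subst {n} t i (`∀ m j φ) = if sameVar m j n i then `∀ m j φ else `∀ m j (subst t i φ)
subst {n} t i (`∃ m j φ) = if sameVar m j n i then `∃ m j φ else `∃ m j (subst t i φ)

FreeFor : {n : ℕ} → Term n → ℕ → Form → Set
FreeFor t i (u `= v) = ⊤
FreeFor t i (u `∈ v) = ⊤
FreeFor t i `⊥ = ⊤
FreeFor t i (φ `∧ ψ) = FreeFor t i φ × FreeFor t i ψ
FreeFor t i (φ `∨ ψ) = FreeFor t i φ × FreeFor t i ψ
FreeFor t i (φ `⊃ ψ) = FreeFor t i φ × FreeFor t i ψ
FreeFor {n} t i (`∀ m j φ) =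
  if sameVar m j n i then ⊤
  else ((freeIn n i φ ≡ false) ⊎ ((occursT m j t ≡ false) × FreeFor t i φ))
FreeFor {n} t i (`∃ m j φ) =
  if sameVar m j n i then ⊤
  else ((freeIn n i φ ≡ false) ⊎ ((occursT m j t ≡ false) × FreeFor t i φ))

InL : ℕ → Form → Set
InL s (_`=_ {n} t u) = n ≤ s
InL s (_`∈_ {n} t u) = suc n ≤ s
InL s `⊥ = ⊤
InL s (φ `∧ ψ) = InL s φ × InL s ψ
InL s (φ `∨ ψ) = InL s φ × InL s ψ
InL s (φ `⊃ ψ) = InL s φ × InL s ψ
InL s (`∀ m j φ) = m ≤ s × InL s φ
InL s (`∃ m j φ) = m ≤ s × InL s φ

data LogAx : Form → Set where
  axK   : ∀ φ ψ → LogAx (φ `⊃ ψ `⊃ φ)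
  axS   : ∀ φ ψ χ → LogAx ((φ `⊃ ψ `⊃ χ) `⊃ (φ `⊃ ψ) `⊃ φ `⊃ χ)
  ∧I    : ∀ φ ψ → LogAx (φ `⊃ ψ `⊃ (φ `∧ ψ))
  ∧E₁   : ∀ φ ψ → LogAx ((φ `∧ ψ) `⊃ φ)
  ∧E₂   : ∀ φ ψ → LogAx ((φ `∧ ψ) `⊃ ψ)
  ∨I₁   : ∀ φ ψ → LogAx (φ `⊃ (φ `∨ ψ))
  ∨I₂   : ∀ φ ψ → LogAx (ψ `⊃ (φ `∨ ψ))
  ∨E    : ∀ φ ψ χ → LogAx ((φ `⊃ χ) `⊃ (ψ `⊃ χ) `⊃ (φ `∨ ψ) `⊃ χ)
  ⊥E    : ∀ φ → LogAx (`⊥ `⊃ φ)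
  dne   : ∀ φ → LogAx (`¬ `¬ φ `⊃ φ)
  ∀E    : ∀ {n} i φ (t : Term n) → FreeFor t i φ → LogAx (`∀ n i φ `⊃ subst t i φ)
  ∃I    : ∀ {n} i φ (t : Term n) → FreeFor t i φ → LogAx (subst t i φ `⊃ `∃ n i φ)
  =refl : ∀ {n} (t : Term n) → LogAx (t `= t)
  =subst : ∀ {n} i φ (t u : Term n) → FreeFor t i φ → FreeFor u i φ →
           LogAx (t `= u `⊃ subst t i φ `⊃ subst u i φ)

data Prov (s : ℕ) (Γ : Form → Set) : Form → Set where
  ax  : ∀ {φ} → Γ φ → InL s φ → Prov s Γ φ
  lax : ∀ {φ} → LogAx φ → InL s φ → Prov s Γ φ
  mp  : ∀ {φ ψ} → Prov s Γ (φ `⊃ ψ) → Prov s Γ φ → Prov s Γ ψ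
  ∀R  : ∀ {φ ψ n i} → n ≤ s → freeIn n i ψ ≡ false →
        Prov s Γ (ψ `⊃ φ) → Prov s Γ (ψ `⊃ `∀ n i φ)
  ∃L  : ∀ {φ ψ n i} → n ≤ s → freeIn n i ψ ≡ false →
        Prov s Γ (φ `⊃ ψ) → Prov s Γ (`∃ n i φ `⊃ ψ)

-- Nonlogical axioms of TI; the flag says whether extensionality is included.

x₀ y₀ : Term 0
x₀ = var 0 0
y₀ = var 0 1

data TIAx (withExt : Bool) : Form → Set where
  pa1 : TIAx withExt (`∀ 0 0 (`¬ (`S x₀ `= `0)))
  pa2 : TIAx withExt (`∀ 0 0 (`∀ 0 1 (`S x₀ `= `S y₀ `⊃ x₀ `= y₀)))
  pa3 : TIAx withExt (`∀ 0 0 (x₀ `+ `0 `= x₀))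
  pa4 : TIAx withExt (`∀ 0 0 (`∀ 0 1 (x₀ `+ `S y₀ `= `S (x₀ `+ y₀))))
  pa5 : TIAx withExt (`∀ 0 0 (x₀ `· `0 `= `0))
  pa6 : TIAx withExt (`∀ 0 0 (`∀ 0 1 (x₀ `· `S y₀ `= (x₀ `· y₀) `+ x₀)))
  ind : ∀ i φ →
        TIAx withExt ((subst `0 i φ `∧ `∀ 0 i (φ `⊃ subst (`S (var 0 i)) i φ))
                      `⊃ `∀ 0 i φ)
  comp : ∀ n i j φ → freeIn (suc n) i φ ≡ false →
         (∀ m k → freeIn m k φ ≡ true → m ≤ suc n) →
         TIAx withExt (`∃ (suc n) i (`∀ n j ((var n j `∈ var (suc n) i) `⇔ φ)))
  ext : withExt ≡ true → ∀ n i j k →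
        TIAx withExt (`∀ n k ((var n k `∈ var (suc n) i) `⇔ (var n k `∈ var (suc n) j))
                      `⊃ var (suc n) i `= var (suc n) j)

bAll bEx : (n i : ℕ) → Term (suc n) → Form → Form
bAll n i τ A = `∀ n i ((var n i `∈ τ) `⊃ A)
bEx  n i τ A = `∃ n i ((var n i `∈ τ) `∧ A)

-- x ≈_n y ; bound variables z^n, u^n are x^n_0, x^n_1 (these have a
-- type different from x, y, so no capture can occur)
approx : (n : ℕ) → Term n → Term n → Form
approx zero t u = t `= u
approx (suc n) x y =
  bAll n 0 x (bEx n 1 y (approx n (var n 0) (var n 1))) `∧
  bAll n 0 y (bEx n 1 x (approx n (var n 0) (var n 1)))

fresh : {n : ℕ} → Term n → ℕ
fresh (var _ j) = suc j
fresh `0 = 0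
fresh (`S t) = fresh t
fresh (t `+ u) = fresh t ⊔ fresh u
fresh (t `· u) = fresh t ⊔ fresh u

star : Form → Form
star (_`=_ {n} t u) = approx n t u
star (_`∈_ {n} t τ) = bEx n (fresh t) τ (approx n (var n (fresh t)) t)
star `⊥ = `⊥
star (φ `∧ ψ) = star φ `∧ star ψ
star (φ `∨ ψ) = star φ `∨ star ψ
star (φ `⊃ ψ) = star φ `⊃ star ψ
star (`∀ n i φ) = `∀ n i (star φ)
star (`∃ n i φ) = `∃ n i (star φ)

TI⊢ : ℕ → Form → Set
TI⊢ s = Prov s (TIAx true)

TI*⊢ : ℕ → Form → Set
TI*⊢ s = Prov s (TIAx false)

-- The translation reads = as the hereditarily extensional equivalence ≈ and ∈ as
-- membership up to ≈, which makes extensionality hold by definition. Without extensionality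
-- ≈ is still provably an equivalence relation, and every translated formula respects it in
-- each free variable; this yields the translated equality axioms and, since the translation
-- commutes with substitution up to provable equivalence, the translated quantifier axioms.
-- Translated induction and comprehension are instances of induction and comprehension for
-- φ* (for comprehension, the set defined by φ* is ≈-closed because φ* respects ≈).

module Submission where

open import Defs
open import Data.Nat using (ℕ; zero; suc; _≤_; _≡ᵇ_; _⊔_; _≟_; z≤n; s≤s)
open import Data.Nat.Properties using (≤-trans; m≤m⊔n; m≤n⊔m; m⊔n≤o⇒m≤o; m⊔n≤o⇒n≤o; ≤-refl; n≤1+n; ⊔-lub; 1+n≢n; <⇒≤; <⇒≢)
open import Data.Bool using (true; false; _∧_; _∨_)
open import Data.List using (List; []; _∷_; foldr)
open import Data.List.Relation.Unary.All using (All; []; _∷_)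
open import Data.List.Relation.Unary.All.Properties using (++⁺; filter⁺)
open import Function using (_∘_)
open import Relation.Nullary.Decidable using (T?)
open import Data.Product using (_×_; _,_; proj₁; proj₂)
open import Data.Sum using (_⊎_; inj₁; inj₂)
open import Data.Unit using (tt)
open import Data.Empty using (⊥-elim)
open import Relation.Binary.PropositionalEquality using (_≡_; refl; sym; trans; cong; cong₂; _≢_; ≢-sym)
open import Relation.Nullary using (Dec; yes; no)
open import Data.Bool.Properties using (∨-identityʳ; ∨-comm)

≡ᵇ-refl : ∀ n → (n ≡ᵇ n) ≡ true
≡ᵇ-refl zero = refl
≡ᵇ-refl (suc n) = ≡ᵇ-refl n

≡ᵇ-true⇒≡ : ∀ m n → (m ≡ᵇ n) ≡ true → m ≡ n
≡ᵇ-true⇒≡ zero zero _ = refl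
≡ᵇ-true⇒≡ zero (suc n) ()
≡ᵇ-true⇒≡ (suc m) zero ()
≡ᵇ-true⇒≡ (suc m) (suc n) p = cong suc (≡ᵇ-true⇒≡ m n p)

≢⇒≡ᵇ-false : ∀ m n → m ≢ n → (m ≡ᵇ n) ≡ false
≢⇒≡ᵇ-false zero zero p = ⊥-elim (p refl)
≢⇒≡ᵇ-false zero (suc n) p = refl
≢⇒≡ᵇ-false (suc m) zero p = refl
≢⇒≡ᵇ-false (suc m) (suc n) p = ≢⇒≡ᵇ-false m n (λ e → p (cong suc e))

≡ᵇ-sym : ∀ m n → (m ≡ᵇ n) ≡ (n ≡ᵇ m)
≡ᵇ-sym zero zero = refl
≡ᵇ-sym zero (suc n) = refl
≡ᵇ-sym (suc m) zero = refl
≡ᵇ-sym (suc m) (suc n) = ≡ᵇ-sym m n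

∧-true⁻ : ∀ {a b} → a ∧ b ≡ true → a ≡ true × b ≡ true
∧-true⁻ {true} {true} _ = refl , refl

∨-false⁻ : ∀ {a b} → a ∨ b ≡ false → a ≡ false × b ≡ false
∨-false⁻ {false} {false} _ = refl , refl

∨-false⁺ : ∀ {a b} → a ≡ false → b ≡ false → a ∨ b ≡ false
∨-false⁺ refl refl = refl

sameVar-refl : ∀ n i → sameVar n i n i ≡ true
sameVar-refl n i rewrite ≡ᵇ-refl n | ≡ᵇ-refl i = refl

sameVar-true⁻ : ∀ {m j n i} → sameVar m j n i ≡ true → m ≡ n × j ≡ i
sameVar-true⁻ {m} {j} {n} {i} p with ∧-true⁻ {m ≡ᵇ n} p
... | p1 , p2 = ≡ᵇ-true⇒≡ m n p1 , ≡ᵇ-true⇒≡ j i p2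

sameVar-false-type : ∀ {m j n i} → m ≢ n → sameVar m j n i ≡ false
sameVar-false-type {m} {j} {n} {i} p rewrite ≢⇒≡ᵇ-false m n p = refl

sameVar-false-index : ∀ {m j n i} → j ≢ i → sameVar m j n i ≡ false
sameVar-false-index {m} {j} {n} {i} p rewrite ≢⇒≡ᵇ-false j i p with m ≡ᵇ n
... | true = refl
... | false = refl

sameVar-sym : ∀ m j n i → sameVar m j n i ≡ sameVar n i m j
sameVar-sym m j n i rewrite ≡ᵇ-sym m n | ≡ᵇ-sym j i = refl

data VarComparison (m j n i : ℕ) : Set where
  same : m ≡ n → j ≡ i → VarComparison m j n i
  different : sameVar m j n i ≡ false → VarComparison m j n i

compareVar : ∀ m j n i → VarComparison m j n i
compareVar m j n i with sameVar m j n i in eq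
... | true = let (a , b) = sameVar-true⁻ eq in same a b
... | false = different eq

n≢1+n : ∀ {n} → n ≢ suc n
n≢1+n ()

occursT-otherType : ∀ {m} n i (t : Term m) → n ≢ m → occursT n i t ≡ false
occursT-otherType n i (var m j) p = sameVar-false-type {m} {j} {n} {i} (≢-sym p)
occursT-otherType n i `0 p = refl
occursT-otherType n i (`S t) p = occursT-otherType n i t p
occursT-otherType n i (t `+ u) p = ∨-false⁺ (occursT-otherType n i t p) (occursT-otherType n i u p)
occursT-otherType n i (t `· u) p = ∨-false⁺ (occursT-otherType n i t p) (occursT-otherType n i u p)

substT-otherType : ∀ {n m} (t : Term n) i (u : Term m) → m ≢ n → substT t i u ≡ u
substT-otherType {n} t i (var m j) p with m ≟ n | j ≟ i
... | yes refl | _ = ⊥-elim (p refl)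
... | no _ | _ = refl
substT-otherType t i `0 p = refl
substT-otherType t i (`S u) p = cong `S (substT-otherType t i u p)
substT-otherType t i (u `+ v) p = cong₂ _`+_ (substT-otherType t i u p) (substT-otherType t i v p)
substT-otherType t i (u `· v) p = cong₂ _`·_ (substT-otherType t i u p) (substT-otherType t i v p)

substT-notOccurring : ∀ {n m} (t : Term n) i (u : Term m) → occursT n i u ≡ false → substT t i u ≡ u
substT-notOccurring {n} t i (var m j) p with m ≟ n | j ≟ i
... | yes refl | yes refl with trans (sym (sameVar-refl n i)) p
...   | ()
substT-notOccurring {n} t i (var m j) p | yes refl | no _ = refl
substT-notOccurring {n} t i (var m j) p | no _ | _ = refl
substT-notOccurring t i `0 p = refl
substT-notOccurring t i (`S u) p = cong `S (substT-notOccurring t i u p)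
substT-notOccurring t i (u `+ v) p = let (a , b) = ∨-false⁻ p in cong₂ _`+_ (substT-notOccurring t i u a) (substT-notOccurring t i v b)
substT-notOccurring t i (u `· v) p = let (a , b) = ∨-false⁻ p in cong₂ _`·_ (substT-notOccurring t i u a) (substT-notOccurring t i v b)

substT-var-same : ∀ {n} (t : Term n) i → substT t i (var n i) ≡ t
substT-var-same {n} t i with n ≟ n | i ≟ i
... | yes refl | yes _ = refl
... | yes refl | no q = ⊥-elim (q refl)
... | no q | _ = ⊥-elim (q refl)

substT-var-other : ∀ {n} (t : Term n) i j → j ≢ i → substT t i (var n j) ≡ var n j
substT-var-other {n} t i j p = substT-notOccurring t i (var n j) (sameVar-false-index {n} {j} {n} {i} p)

occursT-var-other : ∀ k j l → l ≢ j → occursT k j (var k l) ≡ false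
occursT-var-other k j l p = sameVar-false-index {k} {l} {k} {j} p

occursT-higherType : ∀ k j (x : Term (suc k)) → occursT k j x ≡ false
occursT-higherType k j x = occursT-otherType k j x n≢1+n

substT-id : ∀ {n m} i (u : Term m) → substT (var n i) i u ≡ u
substT-id {n} i (var m j) with m ≟ n | j ≟ i
... | yes refl | yes refl = refl
... | yes refl | no _ = refl
... | no _ | _ = refl
substT-id i `0 = refl
substT-id i (`S u) = cong `S (substT-id i u)
substT-id i (u `+ v) = cong₂ _`+_ (substT-id i u) (substT-id i v)
substT-id i (u `· v) = cong₂ _`·_ (substT-id i u) (substT-id i v)

substT-renamed : ∀ {n m} (t : Term n) K i (u : Term m) → occursT n K u ≡ false →
              substT t K (substT (var n K) i u) ≡ substT t i u
substT-renamed {n} t K i (var m j) p with m ≟ n | j ≟ i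
... | yes refl | yes refl = substT-var-same t K
... | yes refl | no _ = substT-notOccurring t K (var m j) p
... | no _ | _ = substT-notOccurring t K (var m j) p
substT-renamed t K i `0 p = refl
substT-renamed t K i (`S u) p = cong `S (substT-renamed t K i u p)
substT-renamed t K i (u `+ v) p = let (a , b) = ∨-false⁻ p in cong₂ _`+_ (substT-renamed t K i u a) (substT-renamed t K i v b)
substT-renamed t K i (u `· v) p = let (a , b) = ∨-false⁻ p in cong₂ _`·_ (substT-renamed t K i u a) (substT-renamed t K i v b)

occursT-substT : ∀ {n m} k j (t : Term n) i (u : Term m) → occursT k j u ≡ false → occursT k j t ≡ false →
             occursT k j (substT t i u) ≡ false
occursT-substT {n} k j t i (var m l) p q with m ≟ n | l ≟ i
... | yes refl | yes _ = q
... | yes refl | no _ = p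
... | no _ | _ = p
occursT-substT k j t i `0 p q = refl
occursT-substT k j t i (`S u) p q = occursT-substT k j t i u p q
occursT-substT k j t i (u `+ v) p q = let (a , b) = ∨-false⁻ p in ∨-false⁺ (occursT-substT k j t i u a q) (occursT-substT k j t i v b q)
occursT-substT k j t i (u `· v) p q = let (a , b) = ∨-false⁻ p in ∨-false⁺ (occursT-substT k j t i u a q) (occursT-substT k j t i v b q)

occursT-fresh : ∀ {m} k j (t : Term m) → fresh t ≤ j → occursT k j t ≡ false
occursT-fresh k j (var m i) p = sameVar-false-index {m} {i} {k} {j} (<⇒≢ p)
occursT-fresh k j `0 p = refl
occursT-fresh k j (`S t) p = occursT-fresh k j t p
occursT-fresh k j (t `+ u) p = ∨-false⁺ (occursT-fresh k j t (≤-trans (m≤m⊔n _ _) p)) (occursT-fresh k j u (≤-trans (m≤n⊔m _ _) p))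
occursT-fresh k j (t `· u) p = ∨-false⁺ (occursT-fresh k j t (≤-trans (m≤m⊔n _ _) p)) (occursT-fresh k j u (≤-trans (m≤n⊔m _ _) p))

-- Exceeds the index of every variable of φ, free or bound, and of every binder that
-- star adds to φ (hence the suc in the ∈ case).
indexBound : Form → ℕ
indexBound (t `= u) = fresh t ⊔ fresh u
indexBound (t `∈ u) = suc (fresh t) ⊔ fresh u
indexBound `⊥ = 0
indexBound (φ `∧ ψ) = indexBound φ ⊔ indexBound ψ
indexBound (φ `∨ ψ) = indexBound φ ⊔ indexBound ψ
indexBound (φ `⊃ ψ) = indexBound φ ⊔ indexBound ψ
indexBound (`∀ m j φ) = suc j ⊔ indexBound φ
indexBound (`∃ m j φ) = suc j ⊔ indexBound φ

freeIn-indexBound : ∀ n K φ → indexBound φ ≤ K → freeIn n K φ ≡ false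
freeIn-indexBound n K (t `= u) p = ∨-false⁺ (occursT-fresh n K t (m⊔n≤o⇒m≤o _ _ p)) (occursT-fresh n K u (m⊔n≤o⇒n≤o _ _ p))
freeIn-indexBound n K (t `∈ u) p =
  ∨-false⁺ (occursT-fresh n K t (≤-trans (n≤1+n _) (m⊔n≤o⇒m≤o (suc (fresh t)) (fresh u) p))) (occursT-fresh n K u (m⊔n≤o⇒n≤o (suc (fresh t)) _ p))
freeIn-indexBound n K `⊥ p = refl
freeIn-indexBound n K (φ `∧ ψ) p = ∨-false⁺ (freeIn-indexBound n K φ (m⊔n≤o⇒m≤o _ _ p)) (freeIn-indexBound n K ψ (m⊔n≤o⇒n≤o _ _ p))
freeIn-indexBound n K (φ `∨ ψ) p = ∨-false⁺ (freeIn-indexBound n K φ (m⊔n≤o⇒m≤o _ _ p)) (freeIn-indexBound n K ψ (m⊔n≤o⇒n≤o _ _ p))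
freeIn-indexBound n K (φ `⊃ ψ) p = ∨-false⁺ (freeIn-indexBound n K φ (m⊔n≤o⇒m≤o _ _ p)) (freeIn-indexBound n K ψ (m⊔n≤o⇒n≤o _ _ p))
freeIn-indexBound n K (`∀ m j φ) p with sameVar m j n K
... | true = refl
... | false = freeIn-indexBound n K φ (m⊔n≤o⇒n≤o _ _ p)
freeIn-indexBound n K (`∃ m j φ) p with sameVar m j n K
... | true = refl
... | false = freeIn-indexBound n K φ (m⊔n≤o⇒n≤o _ _ p)

subst-notFree : ∀ {n} (t : Term n) i φ → freeIn n i φ ≡ false → subst t i φ ≡ φ
subst-notFree t i (u `= v) p = let (a , b) = ∨-false⁻ p in cong₂ _`=_ (substT-notOccurring t i u a) (substT-notOccurring t i v b)
subst-notFree t i (u `∈ v) p = let (a , b) = ∨-false⁻ p in cong₂ _`∈_ (substT-notOccurring t i u a) (substT-notOccurring t i v b)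
subst-notFree t i `⊥ p = refl
subst-notFree t i (φ `∧ ψ) p = let (a , b) = ∨-false⁻ p in cong₂ _`∧_ (subst-notFree t i φ a) (subst-notFree t i ψ b)
subst-notFree t i (φ `∨ ψ) p = let (a , b) = ∨-false⁻ p in cong₂ _`∨_ (subst-notFree t i φ a) (subst-notFree t i ψ b)
subst-notFree t i (φ `⊃ ψ) p = let (a , b) = ∨-false⁻ p in cong₂ _`⊃_ (subst-notFree t i φ a) (subst-notFree t i ψ b)
subst-notFree {n} t i (`∀ m j φ) p with sameVar m j n i
... | true = refl
... | false = cong (`∀ m j) (subst-notFree t i φ p)
subst-notFree {n} t i (`∃ m j φ) p with sameVar m j n i
... | true = refl
... | false = cong (`∃ m j) (subst-notFree t i φ p)

subst-id : ∀ n i φ → subst (var n i) i φ ≡ φ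
subst-id n i (u `= v) = cong₂ _`=_ (substT-id i u) (substT-id i v)
subst-id n i (u `∈ v) = cong₂ _`∈_ (substT-id i u) (substT-id i v)
subst-id n i `⊥ = refl
subst-id n i (φ `∧ ψ) = cong₂ _`∧_ (subst-id n i φ) (subst-id n i ψ)
subst-id n i (φ `∨ ψ) = cong₂ _`∨_ (subst-id n i φ) (subst-id n i ψ)
subst-id n i (φ `⊃ ψ) = cong₂ _`⊃_ (subst-id n i φ) (subst-id n i ψ)
subst-id n i (`∀ m j φ) with sameVar m j n i
... | true = refl
... | false = cong (`∀ m j) (subst-id n i φ)
subst-id n i (`∃ m j φ) with sameVar m j n i
... | true = refl
... | false = cong (`∃ m j) (subst-id n i φ)

subst-renamed : ∀ {n} (t : Term n) K i φ → indexBound φ ≤ K → subst t K (subst (var n K) i φ) ≡ subst t i φ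
subst-renamed t K i (u `= v) p =
  cong₂ _`=_ (substT-renamed t K i u (occursT-fresh _ K u (m⊔n≤o⇒m≤o _ _ p))) (substT-renamed t K i v (occursT-fresh _ K v (m⊔n≤o⇒n≤o _ _ p)))
subst-renamed t K i (u `∈ v) p =
  cong₂ _`∈_ (substT-renamed t K i u (occursT-fresh _ K u (≤-trans (n≤1+n _) (m⊔n≤o⇒m≤o (suc (fresh u)) (fresh v) p))))
             (substT-renamed t K i v (occursT-fresh _ K v (m⊔n≤o⇒n≤o (suc (fresh u)) _ p)))
subst-renamed t K i `⊥ p = refl
subst-renamed t K i (φ `∧ ψ) p = cong₂ _`∧_ (subst-renamed t K i φ (m⊔n≤o⇒m≤o _ _ p)) (subst-renamed t K i ψ (m⊔n≤o⇒n≤o _ _ p))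
subst-renamed t K i (φ `∨ ψ) p = cong₂ _`∨_ (subst-renamed t K i φ (m⊔n≤o⇒m≤o _ _ p)) (subst-renamed t K i ψ (m⊔n≤o⇒n≤o _ _ p))
subst-renamed t K i (φ `⊃ ψ) p = cong₂ _`⊃_ (subst-renamed t K i φ (m⊔n≤o⇒m≤o _ _ p)) (subst-renamed t K i ψ (m⊔n≤o⇒n≤o _ _ p))
subst-renamed {n} t K i (`∀ m j φ) p with sameVar m j n i
... | true = subst-notFree t K (`∀ m j φ) (freeIn-indexBound n K (`∀ m j φ) p)
... | false rewrite sameVar-false-index {m} {j} {n} {K} (<⇒≢ (m⊔n≤o⇒m≤o (suc j) (indexBound φ) p)) = cong (`∀ m j) (subst-renamed t K i φ (m⊔n≤o⇒n≤o _ _ p))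
subst-renamed {n} t K i (`∃ m j φ) p with sameVar m j n i
... | true = subst-notFree t K (`∃ m j φ) (freeIn-indexBound n K (`∃ m j φ) p)
... | false rewrite sameVar-false-index {m} {j} {n} {K} (<⇒≢ (m⊔n≤o⇒m≤o (suc j) (indexBound φ) p)) = cong (`∃ m j) (subst-renamed t K i φ (m⊔n≤o⇒n≤o _ _ p))

freeFor-onlyVar : ∀ {n} (t : Term n) i φ → (∀ m j → sameVar m j n i ≡ false → occursT m j t ≡ false) → FreeFor t i φ
freeFor-onlyVar t i (u `= v) h = tt
freeFor-onlyVar t i (u `∈ v) h = tt
freeFor-onlyVar t i `⊥ h = tt
freeFor-onlyVar t i (φ `∧ ψ) h = freeFor-onlyVar t i φ h , freeFor-onlyVar t i ψ h
freeFor-onlyVar t i (φ `∨ ψ) h = freeFor-onlyVar t i φ h , freeFor-onlyVar t i ψ h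
freeFor-onlyVar t i (φ `⊃ ψ) h = freeFor-onlyVar t i φ h , freeFor-onlyVar t i ψ h
freeFor-onlyVar {n} t i (`∀ m j φ) h with sameVar m j n i in eq
... | true = tt
... | false = inj₂ (h m j eq , freeFor-onlyVar t i φ h)
freeFor-onlyVar {n} t i (`∃ m j φ) h with sameVar m j n i in eq
... | true = tt
... | false = inj₂ (h m j eq , freeFor-onlyVar t i φ h)

freeFor-self : ∀ n i φ → FreeFor (var n i) i φ
freeFor-self n i φ = freeFor-onlyVar (var n i) i φ (λ m j e → trans (sameVar-sym n i m j) e)

freeFor-renamed : ∀ {n} (t : Term n) K i φ → FreeFor t i φ → indexBound φ ≤ K → FreeFor t K (subst (var n K) i φ)
freeFor-renamed t K i (u `= v) f p = tt
freeFor-renamed t K i (u `∈ v) f p = tt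
freeFor-renamed t K i `⊥ f p = tt
freeFor-renamed t K i (φ `∧ ψ) (f , g) p = freeFor-renamed t K i φ f (m⊔n≤o⇒m≤o _ _ p) , freeFor-renamed t K i ψ g (m⊔n≤o⇒n≤o _ _ p)
freeFor-renamed t K i (φ `∨ ψ) (f , g) p = freeFor-renamed t K i φ f (m⊔n≤o⇒m≤o _ _ p) , freeFor-renamed t K i ψ g (m⊔n≤o⇒n≤o _ _ p)
freeFor-renamed t K i (φ `⊃ ψ) (f , g) p = freeFor-renamed t K i φ f (m⊔n≤o⇒m≤o _ _ p) , freeFor-renamed t K i ψ g (m⊔n≤o⇒n≤o _ _ p)
freeFor-renamed {n} t K i (`∀ m j φ) f p with sameVar m j n i
... | true rewrite sameVar-false-index {m} {j} {n} {K} (<⇒≢ (m⊔n≤o⇒m≤o (suc j) (indexBound φ) p)) = inj₁ (freeIn-indexBound n K φ (m⊔n≤o⇒n≤o _ _ p))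
... | false rewrite sameVar-false-index {m} {j} {n} {K} (<⇒≢ (m⊔n≤o⇒m≤o (suc j) (indexBound φ) p)) with f
...   | inj₁ nf rewrite subst-notFree (var n K) i φ nf = inj₁ (freeIn-indexBound n K φ (m⊔n≤o⇒n≤o _ _ p))
...   | inj₂ (o , g) = inj₂ (o , freeFor-renamed t K i φ g (m⊔n≤o⇒n≤o _ _ p))
freeFor-renamed {n} t K i (`∃ m j φ) f p with sameVar m j n i
... | true rewrite sameVar-false-index {m} {j} {n} {K} (<⇒≢ (m⊔n≤o⇒m≤o (suc j) (indexBound φ) p)) = inj₁ (freeIn-indexBound n K φ (m⊔n≤o⇒n≤o _ _ p))
... | false rewrite sameVar-false-index {m} {j} {n} {K} (<⇒≢ (m⊔n≤o⇒m≤o (suc j) (indexBound φ) p)) with f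
...   | inj₁ nf rewrite subst-notFree (var n K) i φ nf = inj₁ (freeIn-indexBound n K φ (m⊔n≤o⇒n≤o _ _ p))
...   | inj₂ (o , g) = inj₂ (o , freeFor-renamed t K i φ g (m⊔n≤o⇒n≤o _ _ p))

freeIn-subst : ∀ {n} k j (t : Term n) i φ → freeIn k j φ ≡ false → occursT k j t ≡ false → freeIn k j (subst t i φ) ≡ false
freeIn-subst k j t i (u `= v) p q = let (a , b) = ∨-false⁻ p in ∨-false⁺ (occursT-substT k j t i u a q) (occursT-substT k j t i v b q)
freeIn-subst k j t i (u `∈ v) p q = let (a , b) = ∨-false⁻ p in ∨-false⁺ (occursT-substT k j t i u a q) (occursT-substT k j t i v b q)
freeIn-subst k j t i `⊥ p q = refl
freeIn-subst k j t i (φ `∧ ψ) p q = let (a , b) = ∨-false⁻ p in ∨-false⁺ (freeIn-subst k j t i φ a q) (freeIn-subst k j t i ψ b q)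
freeIn-subst k j t i (φ `∨ ψ) p q = let (a , b) = ∨-false⁻ p in ∨-false⁺ (freeIn-subst k j t i φ a q) (freeIn-subst k j t i ψ b q)
freeIn-subst k j t i (φ `⊃ ψ) p q = let (a , b) = ∨-false⁻ p in ∨-false⁺ (freeIn-subst k j t i φ a q) (freeIn-subst k j t i ψ b q)
freeIn-subst {n} k j t i (`∀ m l φ) p q with sameVar m l n i
... | true = p
... | false with sameVar m l k j
...   | true = refl
...   | false = freeIn-subst k j t i φ p q
freeIn-subst {n} k j t i (`∃ m l φ) p q with sameVar m l n i
... | true = p
... | false with sameVar m l k j
...   | true = refl
...   | false = freeIn-subst k j t i φ p q

InL-subst⁺ : ∀ s {n} (t : Term n) i φ → InL s φ → InL s (subst t i φ)
InL-subst⁺ s t i (u `= v) w = w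
InL-subst⁺ s t i (u `∈ v) w = w
InL-subst⁺ s t i `⊥ w = w
InL-subst⁺ s t i (φ `∧ ψ) (a , b) = InL-subst⁺ s t i φ a , InL-subst⁺ s t i ψ b
InL-subst⁺ s t i (φ `∨ ψ) (a , b) = InL-subst⁺ s t i φ a , InL-subst⁺ s t i ψ b
InL-subst⁺ s t i (φ `⊃ ψ) (a , b) = InL-subst⁺ s t i φ a , InL-subst⁺ s t i ψ b
InL-subst⁺ s {n} t i (`∀ m j φ) (a , b) with sameVar m j n i
... | true = a , b
... | false = a , InL-subst⁺ s t i φ b
InL-subst⁺ s {n} t i (`∃ m j φ) (a , b) with sameVar m j n i
... | true = a , b
... | false = a , InL-subst⁺ s t i φ b

InL-subst⁻ : ∀ s {n} (t : Term n) i φ → InL s (subst t i φ) → InL s φ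
InL-subst⁻ s t i (u `= v) w = w
InL-subst⁻ s t i (u `∈ v) w = w
InL-subst⁻ s t i `⊥ w = w
InL-subst⁻ s t i (φ `∧ ψ) (a , b) = InL-subst⁻ s t i φ a , InL-subst⁻ s t i ψ b
InL-subst⁻ s t i (φ `∨ ψ) (a , b) = InL-subst⁻ s t i φ a , InL-subst⁻ s t i ψ b
InL-subst⁻ s t i (φ `⊃ ψ) (a , b) = InL-subst⁻ s t i φ a , InL-subst⁻ s t i ψ b
InL-subst⁻ s {n} t i (`∀ m j φ) w with sameVar m j n i
... | true = w
... | false = proj₁ w , InL-subst⁻ s t i φ (proj₂ w)
InL-subst⁻ s {n} t i (`∃ m j φ) w with sameVar m j n i
... | true = w
... | false = proj₁ w , InL-subst⁻ s t i φ (proj₂ w)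

module _ {n : ℕ} (t : Term n) (i m j : ℕ) (φ : Form) where
  subst-∀-same : sameVar m j n i ≡ true → subst t i (`∀ m j φ) ≡ `∀ m j φ
  subst-∀-same e rewrite e = refl
  subst-∀-other : sameVar m j n i ≡ false → subst t i (`∀ m j φ) ≡ `∀ m j (subst t i φ)
  subst-∀-other e rewrite e = refl
  subst-∃-same : sameVar m j n i ≡ true → subst t i (`∃ m j φ) ≡ `∃ m j φ
  subst-∃-same e rewrite e = refl
  subst-∃-other : sameVar m j n i ≡ false → subst t i (`∃ m j φ) ≡ `∃ m j (subst t i φ)
  subst-∃-other e rewrite e = refl
  freeFor-∀⁻ : sameVar m j n i ≡ false → FreeFor t i (`∀ m j φ) → (freeIn n i φ ≡ false) ⊎ ((occursT m j t ≡ false) × FreeFor t i φ)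
  freeFor-∀⁻ e f rewrite e = f
  freeFor-∃⁻ : sameVar m j n i ≡ false → FreeFor t i (`∃ m j φ) → (freeIn n i φ ≡ false) ⊎ ((occursT m j t ≡ false) × FreeFor t i φ)
  freeFor-∃⁻ e f rewrite e = f
  freeFor-∀⁺ : sameVar m j n i ≡ false → (freeIn n i φ ≡ false) ⊎ ((occursT m j t ≡ false) × FreeFor t i φ) → FreeFor t i (`∀ m j φ)
  freeFor-∀⁺ e f rewrite e = f
  freeFor-∃⁺ : sameVar m j n i ≡ false → (freeIn n i φ ≡ false) ⊎ ((occursT m j t ≡ false) × FreeFor t i φ) → FreeFor t i (`∃ m j φ)
  freeFor-∃⁺ e f rewrite e = f

module _ (k j m l : ℕ) (φ : Form) where
  freeIn-∀-same : sameVar m l k j ≡ true → freeIn k j (`∀ m l φ) ≡ false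
  freeIn-∀-same e rewrite e = refl
  freeIn-∀-other : sameVar m l k j ≡ false → freeIn k j (`∀ m l φ) ≡ freeIn k j φ
  freeIn-∀-other e rewrite e = refl
  freeIn-∃-same : sameVar m l k j ≡ true → freeIn k j (`∃ m l φ) ≡ false
  freeIn-∃-same e rewrite e = refl
  freeIn-∃-other : sameVar m l k j ≡ false → freeIn k j (`∃ m l φ) ≡ freeIn k j φ
  freeIn-∃-other e rewrite e = refl

freeIn-∀-self : ∀ m l φ → freeIn m l (`∀ m l φ) ≡ false
freeIn-∀-self m l φ = freeIn-∀-same m l m l φ (sameVar-refl m l)
freeIn-∃-self : ∀ m l φ → freeIn m l (`∃ m l φ) ≡ false
freeIn-∃-self m l φ = freeIn-∃-same m l m l φ (sameVar-refl m l)

freeIn-∀-false : ∀ k j m l φ → freeIn k j φ ≡ false → freeIn k j (`∀ m l φ) ≡ false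
freeIn-∀-false k j m l φ p with compareVar m l k j
... | same refl refl = freeIn-∀-self m l φ
... | different e = trans (freeIn-∀-other k j m l φ e) p
freeIn-∃-false : ∀ k j m l φ → freeIn k j φ ≡ false → freeIn k j (`∃ m l φ) ≡ false
freeIn-∃-false k j m l φ p with compareVar m l k j
... | same refl refl = freeIn-∃-self m l φ
... | different e = trans (freeIn-∃-other k j m l φ e) p

-- approx (suc m) x y unfolds to approxIncl m x y `∧ approxIncl m y x, where approxIncl m x y
-- is (∀ z ∈ x)(∃ u ∈ y) z ≈ u with z, u the variables x^m_0, x^m_1.
approxInclWitness : (m : ℕ) → Term (suc m) → Form
approxInclWitness m y = (var m 1 `∈ y) `∧ approx m (var m 0) (var m 1)

approxInclBody : (m : ℕ) → Term (suc m) → Term (suc m) → Form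
approxInclBody m x y = (var m 0 `∈ x) `⊃ `∃ m 1 (approxInclWitness m y)

approxIncl : (m : ℕ) → Term (suc m) → Term (suc m) → Form
approxIncl m x y = `∀ m 0 (approxInclBody m x y)

approx-subst : ∀ {n} (t : Term n) i m (a b : Term m) → subst t i (approx m a b) ≡ approx m (substT t i a) (substT t i b)
approxIncl-subst : ∀ {n} (t : Term n) i k (x y : Term (suc k)) → subst t i (approxIncl k x y) ≡ approxIncl k (substT t i x) (substT t i y)
approx-subst t i zero a b = refl
approx-subst t i (suc k) a b = cong₂ _`∧_ (approxIncl-subst t i k a b) (approxIncl-subst t i k b a)
approxIncl-subst {n} t i k x y with compareVar k 0 n i
... | same refl refl rewrite subst-∀-same t i k 0 (approxInclBody k x y) (sameVar-refl k 0)
                             | substT-otherType t 0 x 1+n≢n | substT-otherType t 0 y 1+n≢n = refl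
... | different e rewrite subst-∀-other t i k 0 (approxInclBody k x y) e
                     | substT-notOccurring t i (var k 0) e with compareVar k 1 n i
...   | same refl refl rewrite subst-∃-same t 1 k 1 (approxInclWitness k y) (sameVar-refl k 1)
                             | substT-otherType t 1 x 1+n≢n | substT-otherType t 1 y 1+n≢n = refl
...   | different e1 rewrite subst-∃-other t i k 1 (approxInclWitness k y) e1
                     | substT-notOccurring t i (var k 1) e1 | approx-subst t i k (var k 0) (var k 1)
                     | substT-notOccurring t i (var k 0) e | substT-notOccurring t i (var k 1) e1 = refl

∨-dup : ∀ a b → (a ∨ b) ∨ (b ∨ a) ≡ a ∨ b
∨-dup false false = refl
∨-dup false true = refl
∨-dup true b = refl

freeIn-approx : ∀ k j m (a b : Term m) → freeIn k j (approx m a b) ≡ occursT k j a ∨ occursT k j b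
freeIn-approxIncl : ∀ k j m (x y : Term (suc m)) → freeIn k j (approxIncl m x y) ≡ occursT k j x ∨ occursT k j y
freeIn-approx k j zero a b = refl
freeIn-approx k j (suc m) a b = trans (cong₂ _∨_ (freeIn-approxIncl k j m a b) (freeIn-approxIncl k j m b a)) (∨-dup (occursT k j a) (occursT k j b))
freeIn-approxIncl k j m x y with compareVar m 0 k j
... | same refl refl = trans (freeIn-∀-self m 0 (approxInclBody m x y)) (sym (cong₂ _∨_ (occursT-otherType m 0 x n≢1+n) (occursT-otherType m 0 y n≢1+n)))
... | different e with compareVar m 1 k j
...   | same refl refl = trans (trans (freeIn-∀-other m 1 m 0 (approxInclBody m x y) e) (cong₂ _∨_ (cong₂ _∨_ e (occursT-otherType m 1 x n≢1+n)) (freeIn-∃-self m 1 (approxInclWitness m y))))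
                                  (sym (cong₂ _∨_ (occursT-otherType m 1 x n≢1+n) (occursT-otherType m 1 y n≢1+n)))
...   | different e1 = trans (freeIn-∀-other k j m 0 (approxInclBody m x y) e)
                     (trans (cong₂ _∨_ (cong₂ _∨_ e refl)
                       (trans (freeIn-∃-other k j m 1 (approxInclWitness m y) e1) (cong₂ _∨_ (cong₂ _∨_ e1 refl) (trans (freeIn-approx k j m (var m 0) (var m 1)) (cong₂ _∨_ e e1)))))
                       (cong (occursT k j x ∨_) (∨-identityʳ (occursT k j y))))

freeIn-approx-false : ∀ k j m (a b : Term m) → occursT k j a ≡ false → occursT k j b ≡ false → freeIn k j (approx m a b) ≡ false
freeIn-approx-false k j m a b p q = trans (freeIn-approx k j m a b) (∨-false⁺ p q)

freeIn-approxIncl-false : ∀ k j (x y : Term (suc k)) → freeIn k j (approxIncl k x y) ≡ false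
freeIn-approxIncl-false k j x y = trans (freeIn-approxIncl k j k x y) (∨-false⁺ (occursT-higherType k j x) (occursT-higherType k j y))

freeIn-star : ∀ k j φ → freeIn k j (star φ) ≡ freeIn k j φ
freeIn-star k j (_`=_ {m} a b) = freeIn-approx k j m a b
freeIn-star k j (_`∈_ {m} a τ) with compareVar m (fresh a) k j
... | same refl refl = trans (freeIn-∃-self m (fresh a) ((var m (fresh a) `∈ τ) `∧ approx m (var m (fresh a)) a))
                             (sym (∨-false⁺ (occursT-fresh m (fresh a) a ≤-refl) (occursT-otherType m (fresh a) τ n≢1+n)))
... | different e = trans (freeIn-∃-other k j m (fresh a) ((var m (fresh a) `∈ τ) `∧ approx m (var m (fresh a)) a) e)
                   (trans (cong₂ _∨_ (cong₂ _∨_ e refl) (trans (freeIn-approx k j m (var m (fresh a)) a) (cong₂ _∨_ e refl)))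
                          (∨-comm (occursT k j τ) (occursT k j a)))
freeIn-star k j `⊥ = refl
freeIn-star k j (φ `∧ ψ) = cong₂ _∨_ (freeIn-star k j φ) (freeIn-star k j ψ)
freeIn-star k j (φ `∨ ψ) = cong₂ _∨_ (freeIn-star k j φ) (freeIn-star k j ψ)
freeIn-star k j (φ `⊃ ψ) = cong₂ _∨_ (freeIn-star k j φ) (freeIn-star k j ψ)
freeIn-star k j (`∀ m l φ) with sameVar m l k j
... | true = refl
... | false = freeIn-star k j φ
freeIn-star k j (`∃ m l φ) with sameVar m l k j
... | true = refl
... | false = freeIn-star k j φ

InL-approx : ∀ s m (a b : Term m) → m ≤ s → InL s (approx m a b)
InL-approx s zero a b p = p
InL-approx s (suc m) a b p = let q = <⇒≤ p ; r = InL-approx s m (var m 0) (var m 1) q in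
  (q , (p , (q , (p , r)))) , (q , (p , (q , (p , r))))

InL-star : ∀ s φ → InL s φ → InL s (star φ)
InL-star s (_`=_ {m} a b) w = InL-approx s m a b w
InL-star s (_`∈_ {m} a τ) w = <⇒≤ w , (w , InL-approx s m _ a (<⇒≤ w))
InL-star s `⊥ w = w
InL-star s (φ `∧ ψ) (a , b) = InL-star s φ a , InL-star s ψ b
InL-star s (φ `∨ ψ) (a , b) = InL-star s φ a , InL-star s ψ b
InL-star s (φ `⊃ ψ) (a , b) = InL-star s φ a , InL-star s ψ b
InL-star s (`∀ m j φ) (a , b) = a , InL-star s φ b
InL-star s (`∃ m j φ) (a , b) = a , InL-star s φ b

binderBound : Form → ℕ
binderBound (t `= u) = 0
binderBound (t `∈ u) = 0
binderBound `⊥ = 0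
binderBound (φ `∧ ψ) = binderBound φ ⊔ binderBound ψ
binderBound (φ `∨ ψ) = binderBound φ ⊔ binderBound ψ
binderBound (φ `⊃ ψ) = binderBound φ ⊔ binderBound ψ
binderBound (`∀ m j φ) = suc j ⊔ binderBound φ
binderBound (`∃ m j φ) = suc j ⊔ binderBound φ

freeFor-var-binderBound : ∀ n K i φ → binderBound φ ≤ K → FreeFor (var n K) i φ
freeFor-var-binderBound n K i (u `= v) p = tt
freeFor-var-binderBound n K i (u `∈ v) p = tt
freeFor-var-binderBound n K i `⊥ p = tt
freeFor-var-binderBound n K i (φ `∧ ψ) p = freeFor-var-binderBound n K i φ (m⊔n≤o⇒m≤o (binderBound φ) _ p) , freeFor-var-binderBound n K i ψ (m⊔n≤o⇒n≤o (binderBound φ) _ p)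
freeFor-var-binderBound n K i (φ `∨ ψ) p = freeFor-var-binderBound n K i φ (m⊔n≤o⇒m≤o (binderBound φ) _ p) , freeFor-var-binderBound n K i ψ (m⊔n≤o⇒n≤o (binderBound φ) _ p)
freeFor-var-binderBound n K i (φ `⊃ ψ) p = freeFor-var-binderBound n K i φ (m⊔n≤o⇒m≤o (binderBound φ) _ p) , freeFor-var-binderBound n K i ψ (m⊔n≤o⇒n≤o (binderBound φ) _ p)
freeFor-var-binderBound n K i (`∀ m j φ) p with compareVar m j n i
... | same refl refl rewrite sameVar-refl m j = tt
... | different e = freeFor-∀⁺ (var n K) i m j φ e
                      (inj₂ (sameVar-false-index {n} {K} {m} {j} (≢-sym (<⇒≢ (m⊔n≤o⇒m≤o (suc j) (binderBound φ) p))) , freeFor-var-binderBound n K i φ (m⊔n≤o⇒n≤o (suc j) _ p)))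
freeFor-var-binderBound n K i (`∃ m j φ) p with compareVar m j n i
... | same refl refl rewrite sameVar-refl m j = tt
... | different e = freeFor-∃⁺ (var n K) i m j φ e
                      (inj₂ (sameVar-false-index {n} {K} {m} {j} (≢-sym (<⇒≢ (m⊔n≤o⇒m≤o (suc j) (binderBound φ) p))) , freeFor-var-binderBound n K i φ (m⊔n≤o⇒n≤o (suc j) _ p)))

binderBound≤indexBound : ∀ φ → binderBound φ ≤ indexBound φ
binderBound≤indexBound (t `= u) = z≤n
binderBound≤indexBound (t `∈ u) = z≤n
binderBound≤indexBound `⊥ = z≤n
binderBound≤indexBound (φ `∧ ψ) = ⊔-lub (≤-trans (binderBound≤indexBound φ) (m≤m⊔n _ _)) (≤-trans (binderBound≤indexBound ψ) (m≤n⊔m (indexBound φ) _))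
binderBound≤indexBound (φ `∨ ψ) = ⊔-lub (≤-trans (binderBound≤indexBound φ) (m≤m⊔n _ _)) (≤-trans (binderBound≤indexBound ψ) (m≤n⊔m (indexBound φ) _))
binderBound≤indexBound (φ `⊃ ψ) = ⊔-lub (≤-trans (binderBound≤indexBound φ) (m≤m⊔n _ _)) (≤-trans (binderBound≤indexBound ψ) (m≤n⊔m (indexBound φ) _))
binderBound≤indexBound (`∀ m j φ) = ⊔-lub (m≤m⊔n (suc j) (indexBound φ)) (≤-trans (binderBound≤indexBound φ) (m≤n⊔m (suc j) _))
binderBound≤indexBound (`∃ m j φ) = ⊔-lub (m≤m⊔n (suc j) (indexBound φ)) (≤-trans (binderBound≤indexBound φ) (m≤n⊔m (suc j) _))

binderBound-approx : ∀ K m (a b : Term m) → 2 ≤ K → binderBound (approx m a b) ≤ K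
binderBound-approx K zero a b p = z≤n
binderBound-approx K (suc m) a b p =
  let h = ⊔-lub (<⇒≤ p) (⊔-lub z≤n (⊔-lub p (⊔-lub z≤n (binderBound-approx K m (var m 0) (var m 1) p)))) in ⊔-lub h h

binderBound-star : ∀ K φ → 2 ≤ K → indexBound φ ≤ K → binderBound (star φ) ≤ K
binderBound-star K (_`=_ {m} a b) p q = binderBound-approx K m a b p
binderBound-star K (_`∈_ {m} a τ) p q = ⊔-lub (m⊔n≤o⇒m≤o (suc (fresh a)) (fresh τ) q) (⊔-lub z≤n (binderBound-approx K m _ a p))
binderBound-star K `⊥ p q = z≤n
binderBound-star K (φ `∧ ψ) p q = ⊔-lub (binderBound-star K φ p (m⊔n≤o⇒m≤o (indexBound φ) _ q)) (binderBound-star K ψ p (m⊔n≤o⇒n≤o (indexBound φ) _ q))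
binderBound-star K (φ `∨ ψ) p q = ⊔-lub (binderBound-star K φ p (m⊔n≤o⇒m≤o (indexBound φ) _ q)) (binderBound-star K ψ p (m⊔n≤o⇒n≤o (indexBound φ) _ q))
binderBound-star K (φ `⊃ ψ) p q = ⊔-lub (binderBound-star K φ p (m⊔n≤o⇒m≤o (indexBound φ) _ q)) (binderBound-star K ψ p (m⊔n≤o⇒n≤o (indexBound φ) _ q))
binderBound-star K (`∀ m j φ) p q = ⊔-lub (m⊔n≤o⇒m≤o (suc j) (indexBound φ) q) (binderBound-star K φ p (m⊔n≤o⇒n≤o (suc j) _ q))
binderBound-star K (`∃ m j φ) p q = ⊔-lub (m⊔n≤o⇒m≤o (suc j) (indexBound φ) q) (binderBound-star K φ p (m⊔n≤o⇒n≤o (suc j) _ q))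

freeFor-approx : ∀ {n} (t : Term n) i m (a b : Term m) → m ≤ n → FreeFor t i (approx m a b)
freeFor-approx t i zero a b p = tt
freeFor-approx {n} t i (suc k) a b p = h a b , h b a
  where
  kn : k ≢ n
  kn = <⇒≢ p
  h : ∀ x y → FreeFor t i (approxIncl k x y)
  h x y = freeFor-∀⁺ t i k 0 (approxInclBody k x y) (sameVar-false-type {k} {0} {n} {i} kn)
            (inj₂ (occursT-otherType k 0 t kn , (tt , freeFor-∃⁺ t i k 1 (approxInclWitness k y) (sameVar-false-type {k} {1} {n} {i} kn)
              (inj₂ (occursT-otherType k 1 t kn , (tt , freeFor-approx t i k (var k 0) (var k 1) (<⇒≤ p)))))))

approxInclBody-instance : ∀ m (σ τ : Term (suc m)) F →
  subst (var m F) 0 (approxInclBody m σ τ) ≡ ((var m F `∈ σ) `⊃ `∃ m 1 ((var m 1 `∈ τ) `∧ approx m (var m F) (var m 1)))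
approxInclBody-instance m σ τ F
  rewrite subst-∃-other (var m F) 0 m 1 (approxInclWitness m τ) (sameVar-false-index {m} {1} {m} {0} (λ ()))
        | substT-var-same (var m F) 0 | substT-otherType (var m F) 0 σ 1+n≢n | substT-otherType (var m F) 0 τ 1+n≢n
        | approx-subst (var m F) 0 m (var m 0) (var m 1) | substT-var-same (var m F) 0 | substT-var-other (var m F) 0 1 (λ ()) = refl

freeFor-approxInclBody : ∀ m (σ τ : Term (suc m)) F → F ≢ 1 → FreeFor (var m F) 0 (approxInclBody m σ τ)
freeFor-approxInclBody m σ τ F F≢1 =
  tt , freeFor-∃⁺ (var m F) 0 m 1 (approxInclWitness m τ) (sameVar-false-index {m} {1} {m} {0} (λ ()))
         (inj₂ (sameVar-false-index {m} {F} {m} {1} F≢1 , (tt , freeFor-approx (var m F) 0 m (var m 0) (var m 1) ≤-refl)))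

freeIn-∃approxInclWitness : ∀ k j (y : Term (suc k)) → 0 ≢ j → freeIn k j (`∃ k 1 (approxInclWitness k y)) ≡ false
freeIn-∃approxInclWitness k j y 0≢j with compareVar k 1 k j
... | same _ refl = freeIn-∃-self k 1 (approxInclWitness k y)
... | different e = trans (freeIn-∃-other k j k 1 (approxInclWitness k y) e)
                          (∨-false⁺ (∨-false⁺ e (occursT-higherType k j y)) (freeIn-approx-false k j k (var k 0) (var k 1) (occursT-var-other k j 0 0≢j) e))

-- star (a `∈ τ) is approxMem m (fresh a) τ a.
approxMem : ∀ m → ℕ → Term (suc m) → Term m → Form
approxMem m f τ a = bEx m f τ (approx m (var m f) a)

freeIn-approxMem : ∀ k j m f (τ : Term (suc m)) (a : Term m) → occursT k j a ≡ false → occursT k j τ ≡ false →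
                   freeIn k j (approxMem m f τ a) ≡ false
freeIn-approxMem k j m f τ a pa pτ with compareVar m f k j
... | same refl refl = freeIn-∃-self m f ((var m f `∈ τ) `∧ approx m (var m f) a)
... | different e = trans (freeIn-∃-other k j m f ((var m f `∈ τ) `∧ approx m (var m f) a) e)
                          (∨-false⁺ (∨-false⁺ e pτ) (freeIn-approx-false k j m (var m f) a e pa))

approxMem-subst : ∀ {n} (t : Term n) i m f τ a → sameVar m f n i ≡ false →
                  subst t i (approxMem m f τ a) ≡ approxMem m f (substT t i τ) (substT t i a)
approxMem-subst t i m f τ a e rewrite subst-∃-other t i m f ((var m f `∈ τ) `∧ approx m (var m f) a) e | substT-notOccurring t i (var m f) e
                              | approx-subst t i m (var m f) a | substT-notOccurring t i (var m f) e = refl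

freeFor-approxMem : ∀ {n} (t : Term n) i m f τ a → m ≤ n → occursT m f t ≡ false → FreeFor t i (approxMem m f τ a)
freeFor-approxMem {n} t i m f τ a mn o with compareVar m f n i
... | same refl refl rewrite sameVar-refl m f = tt
... | different e = freeFor-∃⁺ t i m f ((var m f `∈ τ) `∧ approx m (var m f) a) e (inj₂ (o , (tt , freeFor-approx t i m (var m f) a mn)))

-- A context is a right-nested conjunction A₁ `∧ (A₂ `∧ (… `∧ `⊤)), and G ⊩ φ is
-- derivability of G `⊃ φ; hypotheses are accessed with ⊩-head and ⊩-weaken.
module NaturalDeduction (s : ℕ) (Γ : Form → Set) where

  infix 2 ⊢_ _⊩_
  ⊢_ : Form → Set
  ⊢ φ = Prov s Γ φ

  _⊩_ : Form → Form → Set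
  G ⊩ φ = ⊢ (G `⊃ φ)

  Wf : Form → Set
  Wf = InL s

  cast⊢ : ∀ {φ ψ} → φ ≡ ψ → ⊢ φ → ⊢ ψ
  cast⊢ refl p = p

  wf-⊢ : ∀ {φ} → ⊢ φ → Wf φ
  wf-⊢ (ax _ w) = w
  wf-⊢ (lax _ w) = w
  wf-⊢ (mp p q) = proj₂ (wf-⊢ p)
  wf-⊢ (∀R n≤ _ p) = let (a , b) = wf-⊢ p in a , (n≤ , b)
  wf-⊢ (∃L n≤ _ p) = let (a , b) = wf-⊢ p in (n≤ , a) , b

  wf-⊢ˡ : ∀ {φ ψ} → ⊢ (φ `⊃ ψ) → Wf φ
  wf-⊢ˡ p = proj₁ (wf-⊢ p)

  wf-⊢ʳ : ∀ {φ ψ} → ⊢ (φ `⊃ ψ) → Wf ψ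
  wf-⊢ʳ p = proj₂ (wf-⊢ p)

  wf-⊤ : Wf `⊤
  wf-⊤ = tt , tt

  ⊢⇒⊩ : ∀ {G φ} → Wf G → ⊢ φ → G ⊩ φ
  ⊢⇒⊩ {G} {φ} wG p = mp (lax (axK φ G) (wf-⊢ p , (wG , wf-⊢ p))) p

  ⊩-mp : ∀ {G A B} → G ⊩ (A `⊃ B) → G ⊩ A → G ⊩ B
  ⊩-mp {G} {A} {B} p q = let (wG , (wA , wB)) = wf-⊢ p in
    mp (mp (lax (axS G A B) ((wG , (wA , wB)) , ((wG , wA) , (wG , wB)))) p) q

  ⊢-id : ∀ {φ} → Wf φ → ⊢ (φ `⊃ φ)
  ⊢-id {φ} w = ⊩-mp (lax (axK φ (φ `⊃ φ)) (w , ((w , w) , w))) (lax (axK φ φ) (w , (w , w)))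

  ⊃-trans : ∀ {A B C} → ⊢ (A `⊃ B) → ⊢ (B `⊃ C) → ⊢ (A `⊃ C)
  ⊃-trans p q = ⊩-mp (⊢⇒⊩ (wf-⊢ˡ p) q) p

  ⊩-mp₂ : ∀ {G A B C} → ⊢ (A `⊃ B `⊃ C) → G ⊩ A → G ⊩ B → G ⊩ C
  ⊩-mp₂ r a b = ⊩-mp (⊃-trans a r) b

  ⊃-flip : ∀ {A G B} → ⊢ (A `⊃ G `⊃ B) → ⊢ (G `⊃ A `⊃ B)
  ⊃-flip {A} {G} {B} h = let (wA , (wG , wB)) = wf-⊢ h in
    ⊃-trans (lax (axK G A) (wG , (wA , wG))) (mp (lax (axS A G B) ((wA , (wG , wB)) , ((wA , wG) , (wA , wB)))) h)

  ⊢⇒⊤⊩ : ∀ {φ} → ⊢ φ → `⊤ ⊩ φ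
  ⊢⇒⊤⊩ = ⊢⇒⊩ wf-⊤

  ⊤⊩⇒⊢ : ∀ {φ} → `⊤ ⊩ φ → ⊢ φ
  ⊤⊩⇒⊢ p = mp p (⊢-id tt)

  ⊩-head : ∀ {A G} → Wf A → Wf G → (A `∧ G) ⊩ A
  ⊩-head {A} {G} wA wG = lax (∧E₁ A G) ((wA , wG) , wA)

  ⊩-weaken : ∀ {A G φ} → Wf A → G ⊩ φ → (A `∧ G) ⊩ φ
  ⊩-weaken {A} {G} wA p = ⊃-trans (lax (∧E₂ A G) ((wA , wf-⊢ˡ p) , wf-⊢ˡ p)) p

  ⊃-intro : ∀ {A G B} → (A `∧ G) ⊩ B → G ⊩ (A `⊃ B)
  ⊃-intro {A} {G} {B} p = ⊃-flip (⊃-trans (lax (∧I A G) (wA , (wG , (wA , wG)))) curried)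
    where
    wA = proj₁ (wf-⊢ˡ p)
    wG = proj₂ (wf-⊢ˡ p)
    wB = wf-⊢ʳ p
    curried : ⊢ ((G `⊃ (A `∧ G)) `⊃ (G `⊃ B))
    curried = mp (lax (axS G (A `∧ G) B) ((wG , ((wA , wG) , wB)) , ((wG , (wA , wG)) , (wG , wB)))) (⊢⇒⊩ wG p)

  ⊃-intro⊤ : ∀ {A B} → (A `∧ `⊤) ⊩ B → ⊢ (A `⊃ B)
  ⊃-intro⊤ p = ⊤⊩⇒⊢ (⊃-intro p)

  ⊃-intro₂ : ∀ {A X Y} → (X `∧ (A `∧ `⊤)) ⊩ Y → ⊢ (A `⊃ X `⊃ Y)
  ⊃-intro₂ p = ⊤⊩⇒⊢ (⊃-intro (⊃-intro p))

  ⊢-ignore : ∀ {A X} → Wf A → Wf X → ⊢ (A `⊃ X `⊃ X)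
  ⊢-ignore wA wX = ⊢⇒⊩ wA (⊢-id wX)

  ∧-intro : ∀ {G A B} → G ⊩ A → G ⊩ B → G ⊩ (A `∧ B)
  ∧-intro {G} {A} {B} p q = ⊩-mp (⊩-mp (⊢⇒⊩ (wf-⊢ˡ p) (lax (∧I A B) (wf-⊢ʳ p , (wf-⊢ʳ q , (wf-⊢ʳ p , wf-⊢ʳ q))))) p) q

  ∧-elimˡ : ∀ {G A B} → G ⊩ (A `∧ B) → G ⊩ A
  ∧-elimˡ {G} {A} {B} p = ⊃-trans p (lax (∧E₁ A B) (wf-⊢ʳ p , proj₁ (wf-⊢ʳ p)))

  ∧-elimʳ : ∀ {G A B} → G ⊩ (A `∧ B) → G ⊩ B
  ∧-elimʳ {G} {A} {B} p = ⊃-trans p (lax (∧E₂ A B) (wf-⊢ʳ p , proj₂ (wf-⊢ʳ p)))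

  ∨-introˡ : ∀ {G A B} → Wf B → G ⊩ A → G ⊩ (A `∨ B)
  ∨-introˡ {G} {A} {B} wB p = ⊃-trans p (lax (∨I₁ A B) (wf-⊢ʳ p , (wf-⊢ʳ p , wB)))

  ∨-introʳ : ∀ {G A B} → Wf A → G ⊩ B → G ⊩ (A `∨ B)
  ∨-introʳ {G} {A} {B} wA p = ⊃-trans p (lax (∨I₂ A B) (wf-⊢ʳ p , (wA , wf-⊢ʳ p)))

  ∨-elim : ∀ {G A B C} → G ⊩ (A `∨ B) → (A `∧ G) ⊩ C → (B `∧ G) ⊩ C → G ⊩ C
  ∨-elim {G} {A} {B} {C} p q r =
    let wA = proj₁ (wf-⊢ˡ q) ; wB = proj₁ (wf-⊢ˡ r) ; wC = wf-⊢ʳ q in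
    ⊩-mp (⊩-mp (⊩-mp (⊢⇒⊩ (wf-⊢ˡ p) (lax (∨E A B C) ((wA , wC) , ((wB , wC) , ((wA , wB) , wC))))) (⊃-intro q)) (⊃-intro r)) p

  ∀-intro : ∀ {G n i φ} → n ≤ s → freeIn n i G ≡ false → G ⊩ φ → G ⊩ `∀ n i φ
  ∀-intro = ∀R

  ∀-elim : ∀ {G n i φ} (t : Term n) → FreeFor t i φ → G ⊩ `∀ n i φ → G ⊩ subst t i φ
  ∀-elim {G} {n} {i} {φ} t f p = let w = wf-⊢ʳ p in ⊃-trans p (lax (∀E i φ t f) (w , InL-subst⁺ s t i φ (proj₂ w)))

  ∀-elim-self : ∀ {G n i φ} → G ⊩ `∀ n i φ → G ⊩ φ
  ∀-elim-self {G} {n} {i} {φ} p = cast⊢ (cong (G `⊃_) (subst-id n i φ)) (∀-elim (var n i) (freeFor-self n i φ) p)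

  ∃-intro : ∀ {G n i φ} (t : Term n) → n ≤ s → FreeFor t i φ → G ⊩ subst t i φ → G ⊩ `∃ n i φ
  ∃-intro {G} {n} {i} {φ} t n≤ f p = let w = wf-⊢ʳ p in ⊃-trans p (lax (∃I i φ t f) (w , (n≤ , InL-subst⁻ s t i φ w)))

  ∃-intro-self : ∀ {G n i φ} → n ≤ s → G ⊩ φ → G ⊩ `∃ n i φ
  ∃-intro-self {G} {n} {i} {φ} n≤ p = ∃-intro (var n i) n≤ (freeFor-self n i φ) (cast⊢ (cong (G `⊃_) (sym (subst-id n i φ))) p)

  ∃-elim : ∀ {G n i φ C} → G ⊩ `∃ n i φ → (φ `∧ G) ⊩ C → freeIn n i G ≡ false → freeIn n i C ≡ false → G ⊩ C
  ∃-elim {G} {n} {i} {φ} {C} p q fG fC =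
    let h = ∃L (proj₁ (wf-⊢ʳ p)) (∨-false⁺ fG fC) (⊃-flip (⊃-intro q)) in
    ⊩-mp (⊃-trans p h) (⊢-id (wf-⊢ˡ p))

  ⊩-premise₁ : ∀ {H X} → Wf H → Wf X → (X `∧ (H `∧ `⊤)) ⊩ H
  ⊩-premise₁ wH wX = ⊩-weaken wX (⊩-head wH wf-⊤)

  ⊩-premise₂ : ∀ {H X} → Wf H → Wf X → (X `∧ (H `∧ `⊤)) ⊩ X
  ⊩-premise₂ wH wX = ⊩-head wX (wH , wf-⊤)

  ∧-monoᴴ : ∀ {H A A' B B'} → ⊢ (H `⊃ A `⊃ A') → ⊢ (H `⊃ B `⊃ B') → ⊢ (H `⊃ (A `∧ B) `⊃ (A' `∧ B'))
  ∧-monoᴴ p q = ⊃-intro₂ (∧-intro (⊩-mp₂ p hH (∧-elimˡ hX)) (⊩-mp₂ q hH (∧-elimʳ hX)))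
    where
    wH = wf-⊢ˡ p
    wX = proj₁ (wf-⊢ʳ p) , proj₁ (wf-⊢ʳ q)
    hH = ⊩-premise₁ wH wX
    hX = ⊩-premise₂ wH wX

  ∨-monoᴴ : ∀ {H A A' B B'} → ⊢ (H `⊃ A `⊃ A') → ⊢ (H `⊃ B `⊃ B') → ⊢ (H `⊃ (A `∨ B) `⊃ (A' `∨ B'))
  ∨-monoᴴ p q = ⊃-intro₂ (∨-elim (⊩-premise₂ wH (wA , wB))
                  (∨-introˡ (proj₂ (wf-⊢ʳ q)) (⊩-mp₂ p (⊩-weaken wA hH) (⊩-head wA wG)))
                  (∨-introʳ (proj₂ (wf-⊢ʳ p)) (⊩-mp₂ q (⊩-weaken wB hH) (⊩-head wB wG))))
    where
    wH = wf-⊢ˡ p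
    wA = proj₁ (wf-⊢ʳ p)
    wB = proj₁ (wf-⊢ʳ q)
    wG = (wA , wB) , (wH , wf-⊤)
    hH = ⊩-premise₁ wH (wA , wB)

  ⊃-monoᴴ : ∀ {H A A' B B'} → ⊢ (H `⊃ A' `⊃ A) → ⊢ (H `⊃ B `⊃ B') → ⊢ (H `⊃ (A `⊃ B) `⊃ (A' `⊃ B'))
  ⊃-monoᴴ p q = ⊃-intro₂ (⊃-intro (⊩-mp₂ q hH (⊩-mp hX (⊩-mp₂ p hH (⊩-head wA' wG)))))
    where
    wH = wf-⊢ˡ p
    wA' = proj₁ (wf-⊢ʳ p)
    wX = proj₂ (wf-⊢ʳ p) , proj₁ (wf-⊢ʳ q)
    wG = wX , (wH , wf-⊤)
    hH = ⊩-weaken wA' (⊩-premise₁ wH wX)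
    hX = ⊩-weaken wA' (⊩-premise₂ wH wX)

  ∀-monoᴴ : ∀ {H A B} m j → m ≤ s → freeIn m j H ≡ false → ⊢ (H `⊃ A `⊃ B) → ⊢ (H `⊃ `∀ m j A `⊃ `∀ m j B)
  ∀-monoᴴ {H} {A} m j m≤ fH p =
    ⊃-intro₂ (∀-intro m≤ (∨-false⁺ (freeIn-∀-self m j A) (∨-false⁺ fH refl)) (⊩-mp₂ p (⊩-premise₁ wH wX) (∀-elim-self (⊩-premise₂ wH wX))))
    where
    wH = wf-⊢ˡ p
    wX = m≤ , proj₁ (wf-⊢ʳ p)

  ∃-monoᴴ : ∀ {H A B} m j → m ≤ s → freeIn m j H ≡ false → ⊢ (H `⊃ A `⊃ B) → ⊢ (H `⊃ `∃ m j A `⊃ `∃ m j B)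
  ∃-monoᴴ {H} {A} {B} m j m≤ fH p =
    ⊃-intro₂ (∃-elim (⊩-premise₂ wH wX) (∃-intro-self m≤ (⊩-mp₂ p (⊩-weaken wA (⊩-premise₁ wH wX)) (⊩-head wA (wX , (wH , wf-⊤)))))
                     (∨-false⁺ (freeIn-∃-self m j A) (∨-false⁺ fH refl)) (freeIn-∃-self m j B))
    where
    wH = wf-⊢ˡ p
    wA = proj₁ (wf-⊢ʳ p)
    wX = m≤ , wA

  infix 2 _⟺_
  _⟺_ : Form → Form → Set
  A ⟺ B = (⊢ (A `⊃ B)) × (⊢ (B `⊃ A))

  ⟺-refl : ∀ {A} → Wf A → A ⟺ A
  ⟺-refl w = ⊢-id w , ⊢-id w

  ⟺-cast : ∀ {A B C D} → A ≡ B → C ≡ D → A ⟺ C → B ⟺ D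
  ⟺-cast refl refl e = e

  ∧-mono : ∀ {A A' B B'} → ⊢ (A `⊃ A') → ⊢ (B `⊃ B') → ⊢ ((A `∧ B) `⊃ (A' `∧ B'))
  ∧-mono p q = ⊤⊩⇒⊢ (∧-monoᴴ (⊢⇒⊤⊩ p) (⊢⇒⊤⊩ q))

  ∨-mono : ∀ {A A' B B'} → ⊢ (A `⊃ A') → ⊢ (B `⊃ B') → ⊢ ((A `∨ B) `⊃ (A' `∨ B'))
  ∨-mono p q = ⊤⊩⇒⊢ (∨-monoᴴ (⊢⇒⊤⊩ p) (⊢⇒⊤⊩ q))

  ⊃-mono : ∀ {A A' B B'} → ⊢ (A' `⊃ A) → ⊢ (B `⊃ B') → ⊢ ((A `⊃ B) `⊃ (A' `⊃ B'))
  ⊃-mono p q = ⊤⊩⇒⊢ (⊃-monoᴴ (⊢⇒⊤⊩ p) (⊢⇒⊤⊩ q))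

  ∀-mono : ∀ {A B} m j → m ≤ s → ⊢ (A `⊃ B) → ⊢ (`∀ m j A `⊃ `∀ m j B)
  ∀-mono m j m≤ p = ⊤⊩⇒⊢ (∀-monoᴴ m j m≤ refl (⊢⇒⊤⊩ p))

  ∃-mono : ∀ {A B} m j → m ≤ s → ⊢ (A `⊃ B) → ⊢ (`∃ m j A `⊃ `∃ m j B)
  ∃-mono m j m≤ p = ⊤⊩⇒⊢ (∃-monoᴴ m j m≤ refl (⊢⇒⊤⊩ p))

  ∀-cong : ∀ {A B} m j → m ≤ s → A ⟺ B → `∀ m j A ⟺ `∀ m j B
  ∀-cong m j m≤ (p , q) = ∀-mono m j m≤ p , ∀-mono m j m≤ q

  ∃-cong : ∀ {A B} m j → m ≤ s → A ⟺ B → `∃ m j A ⟺ `∃ m j B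
  ∃-cong m j m≤ (p , q) = ∃-mono m j m≤ p , ∃-mono m j m≤ q

  ∧-cong : ∀ {A A' B B'} → A ⟺ A' → B ⟺ B' → (A `∧ B) ⟺ (A' `∧ B')
  ∧-cong (p , p') (q , q') = ∧-mono p q , ∧-mono p' q'

  ∨-cong : ∀ {A A' B B'} → A ⟺ A' → B ⟺ B' → (A `∨ B) ⟺ (A' `∨ B')
  ∨-cong (p , p') (q , q') = ∨-mono p q , ∨-mono p' q'

  ⊃-cong : ∀ {A A' B B'} → A ⟺ A' → B ⟺ B' → (A `⊃ B) ⟺ (A' `⊃ B')
  ⊃-cong (p , p') (q , q') = ⊃-mono p' q , ⊃-mono p q'

module Approximation (s : ℕ) (Γ : Form → Set) where
  open NaturalDeduction s Γ public

  wf-approx : ∀ m (a b : Term m) → m ≤ s → Wf (approx m a b)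
  wf-approx m a b p = InL-approx s m a b p

  wf-approxIncl : ∀ m (a b : Term (suc m)) → suc m ≤ s → Wf (approxIncl m a b)
  wf-approxIncl m a b p = proj₁ (wf-approx (suc m) a b p)

  wf-approxMem : ∀ m f τ a → suc m ≤ s → Wf (approxMem m f τ a)
  wf-approxMem m f τ a p = <⇒≤ p , (p , wf-approx m (var m f) a (<⇒≤ p))

  =-sym : ∀ (a b : Term 0) → ⊢ (a `= b `⊃ b `= a)
  =-sym a b = mp (⊃-flip (cast⊢ e (lax (=subst z φ a b tt tt) (z≤n , (z≤n , z≤n))))) (lax (=refl a) z≤n)
    where
    z = fresh a ⊔ fresh b
    φ = var 0 z `= a
    za : occursT 0 z a ≡ false
    za = occursT-fresh 0 z a (m≤m⊔n _ _)
    e : (a `= b `⊃ subst a z φ `⊃ subst b z φ) ≡ (a `= b `⊃ a `= a `⊃ b `= a)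
    e rewrite substT-var-same a z | substT-var-same b z | substT-notOccurring a z a za | substT-notOccurring b z a za = refl

  =-trans : ∀ (a b c : Term 0) → ⊢ (a `= b `⊃ b `= c `⊃ a `= c)
  =-trans a b c = ⊃-flip (cast⊢ e (lax (=subst z φ b c tt tt) (z≤n , (z≤n , z≤n))))
    where
    z = fresh a ⊔ fresh b ⊔ fresh c
    φ = a `= var 0 z
    za : occursT 0 z a ≡ false
    za = occursT-fresh 0 z a (≤-trans (m≤m⊔n (fresh a) (fresh b)) (m≤m⊔n _ _))
    e : (b `= c `⊃ subst b z φ `⊃ subst c z φ) ≡ (b `= c `⊃ a `= b `⊃ a `= c)
    e rewrite substT-var-same b z | substT-var-same c z | substT-notOccurring b z a za | substT-notOccurring c z a za = refl

  ≈-refl : ∀ m (a : Term m) → m ≤ s → ⊢ approx m a a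
  ≈-refl zero a p = lax (=refl a) z≤n
  ≈-refl (suc k) a p = ⊤⊩⇒⊢ (∧-intro (⊢⇒⊤⊩ a⊆a) (⊢⇒⊤⊩ a⊆a))
    where
    q = <⇒≤ p
    v0 = var k 0
    e : subst v0 1 (approxInclWitness k a) ≡ ((v0 `∈ a) `∧ approx k v0 v0)
    e rewrite approx-subst v0 1 k v0 (var k 1) | substT-var-same v0 1 | substT-var-other v0 1 0 (λ ())
            | substT-otherType v0 1 a 1+n≢n = refl
    witness : ((v0 `∈ a) `∧ `⊤) ⊩ `∃ k 1 (approxInclWitness k a)
    witness = ∃-intro v0 q (tt , freeFor-approx v0 1 k v0 (var k 1) ≤-refl)
                (cast⊢ (cong (((v0 `∈ a) `∧ `⊤) `⊃_) (sym e))
                  (∧-intro (⊩-head p wf-⊤) (⊢⇒⊩ (p , wf-⊤) (≈-refl k v0 q))))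
    a⊆a : ⊢ approxIncl k a a
    a⊆a = ⊤⊩⇒⊢ (∀-intro q refl (⊃-intro witness))

  ≈-sym : ∀ m (a b : Term m) → m ≤ s → ⊢ (approx m a b `⊃ approx m b a)
  ≈-sym zero a b p = =-sym a b
  ≈-sym (suc k) a b p = let w = wf-approx (suc k) a b p in
    ⊃-intro⊤ (∧-intro (∧-elimʳ (⊩-head w wf-⊤)) (∧-elimˡ (⊩-head w wf-⊤)))

  approxIncl-elim : ∀ m (σ τ : Term (suc m)) F K → suc m ≤ s → F ≢ 1 → F ≢ K →
    ⊢ (approxIncl m σ τ `⊃ (var m F `∈ σ) `⊃ `∃ m K ((var m K `∈ τ) `∧ approx m (var m F) (var m K)))
  approxIncl-elim m σ τ F K p F≢1 F≢K = ⊃-intro₂ (renameWitness (K ≟ 1))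
    where
    q = <⇒≤ p
    vF = var m F
    v1 = var m 1
    wI = wf-approxIncl m σ τ p
    G = (vF `∈ σ) `∧ (approxIncl m σ τ `∧ `⊤)
    wG : Wf G
    wG = p , (wI , wf-⊤)
    C₁ = (v1 `∈ τ) `∧ approx m vF v1
    wC₁ : Wf C₁
    wC₁ = p , wf-approx m vF v1 q
    found : G ⊩ `∃ m 1 C₁
    found = ⊩-mp (cast⊢ (cong (G `⊃_) (approxInclBody-instance m σ τ F))
                   (∀-elim vF (freeFor-approxInclBody m σ τ F F≢1) (⊩-weaken p (⊩-head wI wf-⊤))))
                 (⊩-head p (wI , wf-⊤))
    renameWitness : Dec (K ≡ 1) → G ⊩ `∃ m K ((var m K `∈ τ) `∧ approx m vF (var m K))
    renameWitness (yes refl) = found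
    renameWitness (no K≢1) = ∃-elim found renamed frG frC
      where
      vK = var m K
      eK : subst v1 K ((vK `∈ τ) `∧ approx m vF vK) ≡ C₁
      eK rewrite substT-var-same v1 K | substT-otherType v1 K τ 1+n≢n | approx-subst v1 K m vF vK
               | substT-var-same v1 K | substT-var-other v1 K F F≢K = refl
      renamed : (C₁ `∧ G) ⊩ `∃ m K ((vK `∈ τ) `∧ approx m vF vK)
      renamed = ∃-intro v1 q (tt , freeFor-approx v1 K m vF vK ≤-refl) (cast⊢ (cong ((C₁ `∧ G) `⊃_) (sym eK)) (⊩-head wC₁ wG))
      frG : freeIn m 1 G ≡ false
      frG = ∨-false⁺ (∨-false⁺ (occursT-var-other m 1 F F≢1) (occursT-higherType m 1 σ)) (∨-false⁺ (freeIn-approxIncl-false m 1 σ τ) refl)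
      frC : freeIn m 1 (`∃ m K ((vK `∈ τ) `∧ approx m vF vK)) ≡ false
      frC = freeIn-∃-false m 1 m K ((vK `∈ τ) `∧ approx m vF vK) (∨-false⁺ (∨-false⁺ (occursT-var-other m 1 K K≢1) (occursT-higherType m 1 τ))
                                             (freeIn-approx-false m 1 m vF vK (occursT-var-other m 1 F F≢1) (occursT-var-other m 1 K K≢1)))

  approxIncl-trans : ∀ k → suc k ≤ s → (∀ a b c → ⊢ (approx k a b `⊃ approx k b c `⊃ approx k a c)) →
                     ∀ x y z → ⊢ (approxIncl k x y `⊃ approxIncl k y z `⊃ approxIncl k x z)
  approxIncl-trans k p ≈ₖ-trans x y z = ⊃-intro₂ (∀-intro q (closedG 0) (⊃-intro viaY))
    where
    q = <⇒≤ p
    v0 = var k 0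
    v1 = var k 1
    v2 = var k 2
    G = approxIncl k y z `∧ (approxIncl k x y `∧ `⊤)
    wG : Wf G
    wG = wf-approxIncl k y z p , (wf-approxIncl k x y p , wf-⊤)
    closedG : ∀ j → freeIn k j G ≡ false
    closedG j = ∨-false⁺ (freeIn-approxIncl-false k j y z) (∨-false⁺ (freeIn-approxIncl-false k j x y) refl)
    G₀ = (v0 `∈ x) `∧ G
    freeIn-G₀ : ∀ j → 0 ≢ j → freeIn k j G₀ ≡ false
    freeIn-G₀ j 0≢j = ∨-false⁺ (∨-false⁺ (occursT-var-other k j 0 0≢j) (occursT-higherType k j x)) (closedG j)
    D = (v2 `∈ y) `∧ approx k v0 v2
    wD : Wf D
    wD = p , wf-approx k v0 v2 q
    E = (v1 `∈ z) `∧ approx k v2 v1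
    wE : Wf E
    wE = p , wf-approx k v2 v1 q
    target = `∃ k 1 (approxInclWitness k z)
    conclude : (E `∧ (D `∧ G₀)) ⊩ target
    conclude = ∃-intro-self q (∧-intro (∧-elimˡ hE) (⊩-mp₂ (≈ₖ-trans v0 v2 v1) (∧-elimʳ (⊩-weaken wE (⊩-head wD (p , wG)))) (∧-elimʳ hE)))
      where
      hE = ⊩-head wE (wD , (p , wG))
    viaZ : (D `∧ G₀) ⊩ target
    viaZ = ∃-elim (⊩-mp₂ (approxIncl-elim k y z 2 1 p (λ ()) (λ ()))
                         (⊩-weaken wD (⊩-weaken p (⊩-head (wf-approxIncl k y z p) (wf-approxIncl k x y p , wf-⊤))))
                         (∧-elimˡ (⊩-head wD (p , wG))))
                  conclude
                  (∨-false⁺ (∨-false⁺ (∨-false⁺ (occursT-var-other k 1 2 (λ ())) (occursT-higherType k 1 y))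
                                    (freeIn-approx-false k 1 k v0 v2 (occursT-var-other k 1 0 (λ ())) (occursT-var-other k 1 2 (λ ()))))
                            (freeIn-G₀ 1 (λ ())))
                  (freeIn-∃-self k 1 (approxInclWitness k z))
    viaY : G₀ ⊩ target
    viaY = ∃-elim (⊩-mp₂ (approxIncl-elim k x y 0 2 p (λ ()) (λ ()))
                         (⊩-weaken p (⊩-weaken (wf-approxIncl k y z p) (⊩-head (wf-approxIncl k x y p) wf-⊤)))
                         (⊩-head p wG))
                  viaZ (freeIn-G₀ 2 (λ ())) (freeIn-∃approxInclWitness k 2 z (λ ()))

  ≈-trans : ∀ m (a b c : Term m) → m ≤ s → ⊢ (approx m a b `⊃ approx m b c `⊃ approx m a c)
  ≈-trans zero a b c p = =-trans a b c
  ≈-trans (suc k) a b c p = ⊃-intro₂ (∧-intro (⊩-mp₂ (⊆-trans a b c) (∧-elimˡ hab) (∧-elimˡ hbc))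
                                             (⊩-mp₂ (⊆-trans c b a) (∧-elimʳ hbc) (∧-elimʳ hab)))
    where
    ⊆-trans = approxIncl-trans k p (λ a b c → ≈-trans k a b c (<⇒≤ p))
    hab : (approx (suc k) b c `∧ (approx (suc k) a b `∧ `⊤)) ⊩ approx (suc k) a b
    hab = ⊩-weaken (wf-approx (suc k) b c p) (⊩-head (wf-approx (suc k) a b p) wf-⊤)
    hbc : (approx (suc k) b c `∧ (approx (suc k) a b `∧ `⊤)) ⊩ approx (suc k) b c
    hbc = ⊩-head (wf-approx (suc k) b c p) (wf-approx (suc k) a b p , wf-⊤)

  ≈-substT : ∀ n (t u : Term n) i (a : Term n) → n ≤ s → ⊢ (approx n t u `⊃ approx n (substT t i a) (substT u i a))
  ≈-substT zero t u i a p = mp (⊃-flip (cast⊢ e (lax (=subst z φ t u tt tt) (z≤n , (z≤n , z≤n))))) (lax (=refl (substT t i a)) z≤n)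
    where
    z = fresh a ⊔ fresh t ⊔ fresh u
    za : occursT 0 z a ≡ false
    za = occursT-fresh 0 z a (≤-trans (m≤m⊔n (fresh a) (fresh t)) (m≤m⊔n _ _))
    zt : occursT 0 z t ≡ false
    zt = occursT-fresh 0 z t (≤-trans (m≤n⊔m (fresh a) (fresh t)) (m≤m⊔n _ _))
    zat : occursT 0 z (substT t i a) ≡ false
    zat = occursT-substT 0 z t i a za zt
    φ = substT t i a `= substT (var 0 z) i a
    e : (t `= u `⊃ subst t z φ `⊃ subst u z φ) ≡ (t `= u `⊃ substT t i a `= substT t i a `⊃ substT t i a `= substT u i a)
    e rewrite substT-notOccurring t z (substT t i a) zat | substT-notOccurring u z (substT t i a) zat
            | substT-renamed t z i a za | substT-renamed u z i a za = refl
  ≈-substT (suc k) t u i (var .(suc k) j) p = byIndex (j ≟ i)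
    where
    byIndex : Dec (j ≡ i) → ⊢ (approx (suc k) t u `⊃ approx (suc k) (substT t i (var (suc k) j)) (substT u i (var (suc k) j)))
    byIndex (yes refl) = cast⊢ (cong₂ (λ X Y → approx (suc k) t u `⊃ approx (suc k) X Y) (sym (substT-var-same t j)) (sym (substT-var-same u j)))
                               (⊢-id (wf-approx (suc k) t u p))
    byIndex (no j≢i) = cast⊢ (cong₂ (λ X Y → approx (suc k) t u `⊃ approx (suc k) X Y) (sym (substT-var-other t i j j≢i)) (sym (substT-var-other u i j j≢i)))
                             (⊢⇒⊩ (wf-approx (suc k) t u p) (≈-refl (suc k) (var (suc k) j) p))

  ∈⇒approxMem : ∀ n f (a : Term (suc n)) j → f ≢ j → suc n ≤ s → ⊢ ((var n j `∈ a) `⊃ approxMem n f a (var n j))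
  ∈⇒approxMem n f a j f≢j p =
    ⊃-intro⊤ (∃-intro vj q (tt , freeFor-approx vj f n (var n f) vj ≤-refl)
               (cast⊢ (cong (((vj `∈ a) `∧ `⊤) `⊃_) (sym e)) (∧-intro (⊩-head p wf-⊤) (⊢⇒⊩ (p , wf-⊤) (≈-refl n vj q)))))
    where
    q = <⇒≤ p
    vj = var n j
    e : subst vj f ((var n f `∈ a) `∧ approx n (var n f) vj) ≡ ((vj `∈ a) `∧ approx n vj vj)
    e rewrite substT-var-same vj f | substT-otherType vj f a 1+n≢n | approx-subst vj f n (var n f) vj | substT-var-same vj f
            | substT-var-other vj f j (≢-sym f≢j) = refl

  approxMem-congˡ′ : ∀ m (a b : Term m) (τ : Term (suc m)) f g → suc m ≤ s →
                     occursT m f a ≡ false → occursT m f b ≡ false → occursT m g b ≡ false →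
                     ⊢ (approx m a b `⊃ approxMem m f τ a `⊃ approxMem m g τ b)
  approxMem-congˡ′ m a b τ f g p fa fb gb = ⊃-intro₂ (∃-elim (⊩-premise₂ wab wM) witness frG frC)
    where
    q = <⇒≤ p
    wab = wf-approx m a b q
    wM = wf-approxMem m f τ a p
    G = approxMem m f τ a `∧ (approx m a b `∧ `⊤)
    wG : Wf G
    wG = wM , (wab , wf-⊤)
    B = (var m f `∈ τ) `∧ approx m (var m f) a
    wB : Wf B
    wB = p , wf-approx m (var m f) a q
    e : subst (var m f) g ((var m g `∈ τ) `∧ approx m (var m g) b) ≡ ((var m f `∈ τ) `∧ approx m (var m f) b)
    e rewrite substT-var-same (var m f) g | substT-otherType (var m f) g τ 1+n≢n | approx-subst (var m f) g m (var m g) b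
            | substT-var-same (var m f) g | substT-notOccurring (var m f) g b gb = refl
    witness : (B `∧ G) ⊩ approxMem m g τ b
    witness = ∃-intro (var m f) q (tt , freeFor-approx (var m f) g m (var m g) b ≤-refl)
                (cast⊢ (cong ((B `∧ G) `⊃_) (sym e))
                  (∧-intro (∧-elimˡ (⊩-head wB wG))
                           (⊩-mp₂ (≈-trans m (var m f) a b q) (∧-elimʳ (⊩-head wB wG)) (⊩-weaken wB (⊩-premise₁ wab wM)))))
    frG : freeIn m f G ≡ false
    frG = ∨-false⁺ (freeIn-∃-self m f B) (∨-false⁺ (freeIn-approx-false m f m a b fa fb) refl)
    frC : freeIn m f (approxMem m g τ b) ≡ false
    frC = freeIn-approxMem m f m g τ b fb (occursT-higherType m f τ)

  -- The detour through an index h fresh for both a and b removes the side condition on f and b.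
  approxMem-congˡ : ∀ m (a b : Term m) (τ : Term (suc m)) f g → suc m ≤ s →
                    occursT m f a ≡ false → occursT m g b ≡ false →
                    ⊢ (approx m a b `⊃ approxMem m f τ a `⊃ approxMem m g τ b)
  approxMem-congˡ m a b τ f g p fa gb =
    ⊃-intro₂ (⊩-mp₂ (approxMem-congˡ′ m a b τ h g p ha hb gb) (⊩-premise₁ wab wM)
                    (⊩-mp₂ (approxMem-congˡ′ m a a τ f h p fa fa ha) (⊢⇒⊩ (wM , (wab , wf-⊤)) (≈-refl m a q)) (⊩-premise₂ wab wM)))
    where
    q = <⇒≤ p
    wab = wf-approx m a b q
    wM = wf-approxMem m f τ a p
    h = fresh a ⊔ fresh b
    ha : occursT m h a ≡ false
    ha = occursT-fresh m h a (m≤m⊔n _ _)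
    hb : occursT m h b ≡ false
    hb = occursT-fresh m h b (m≤n⊔m _ _)

  approxMem-congʳ : ∀ m (σ τ : Term (suc m)) (a : Term m) f → suc m ≤ s → occursT m f a ≡ false →
                    ⊢ (approx (suc m) σ τ `⊃ approxMem m f σ a `⊃ approxMem m f τ a)
  approxMem-congʳ m σ τ a f p fa = ⊃-intro₂ (∃-elim memberF inτ (frG F Fa (<⇒≢ fF)) (freeIn-approxMem m F m f τ a Fa (occursT-higherType m F τ)))
    where
    q = <⇒≤ p
    F = suc (suc (fresh a ⊔ f))
    K = suc F
    vF = var m F
    vK = var m K
    fF : suc f ≤ F
    fF = s≤s (≤-trans (m≤n⊔m (fresh a) f) (n≤1+n _))
    Fa : occursT m F a ≡ false
    Fa = occursT-fresh m F a (≤-trans (m≤m⊔n (fresh a) f) (≤-trans (n≤1+n _) (n≤1+n _)))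
    Ka : occursT m K a ≡ false
    Ka = occursT-fresh m K a (≤-trans (m≤m⊔n (fresh a) f) (≤-trans (n≤1+n _) (≤-trans (n≤1+n _) (n≤1+n _))))
    wστ = wf-approx (suc m) σ τ p
    wM = wf-approxMem m f σ a p
    G = approxMem m f σ a `∧ (approx (suc m) σ τ `∧ `⊤)
    wG : Wf G
    wG = wM , (wστ , wf-⊤)
    memberF : G ⊩ approxMem m F σ a
    memberF = ⊩-mp₂ (approxMem-congˡ m a a σ f F p fa Fa) (⊢⇒⊩ wG (≈-refl m a q)) (⊩-premise₂ wστ wM)
    frG : ∀ j → occursT m j a ≡ false → f ≢ j → freeIn m j G ≡ false
    frG j ja fj = ∨-false⁺ (freeIn-approxMem m j m f σ a ja (occursT-higherType m j σ))
                           (∨-false⁺ (freeIn-approx-false m j (suc m) σ τ (occursT-higherType m j σ) (occursT-higherType m j τ)) refl)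
    BF = (vF `∈ σ) `∧ approx m vF a
    wBF : Wf BF
    wBF = p , wf-approx m vF a q
    BK = (vK `∈ τ) `∧ approx m vF vK
    wBK : Wf BK
    wBK = p , wf-approx m vF vK q
    eK : subst vK f ((var m f `∈ τ) `∧ approx m (var m f) a) ≡ ((vK `∈ τ) `∧ approx m vK a)
    eK rewrite substT-var-same vK f | substT-otherType vK f τ 1+n≢n | approx-subst vK f m (var m f) a
             | substT-var-same vK f | substT-notOccurring vK f a fa = refl
    witness : (BK `∧ (BF `∧ G)) ⊩ approxMem m f τ a
    witness = ∃-intro vK q (tt , freeFor-approx vK f m (var m f) a ≤-refl) (cast⊢ (cong ((BK `∧ (BF `∧ G)) `⊃_) (sym eK))
                (∧-intro (∧-elimˡ hBK)
                         (⊩-mp₂ (≈-trans m vK vF a q) (⊩-mp (⊢⇒⊩ (wBK , (wBF , wG)) (≈-sym m vF vK q)) (∧-elimʳ hBK))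
                                (∧-elimʳ (⊩-weaken wBK (⊩-head wBF wG))))))
      where
      hBK = ⊩-head wBK (wBF , wG)
    K∉vF : occursT m K vF ≡ false
    K∉vF = occursT-var-other m K F (<⇒≢ ≤-refl)
    inτ : (BF `∧ G) ⊩ approxMem m f τ a
    inτ = ∃-elim (⊩-mp₂ (approxIncl-elim m σ τ F K p (λ ()) (<⇒≢ ≤-refl)) (∧-elimˡ (⊩-weaken wBF (⊩-premise₁ wστ wM))) (∧-elimˡ (⊩-head wBF wG)))
                 witness
                 (∨-false⁺ (∨-false⁺ (∨-false⁺ K∉vF (occursT-higherType m K σ)) (freeIn-approx-false m K m vF a K∉vF Ka))
                           (frG K Ka (<⇒≢ (≤-trans fF (n≤1+n _)))))
                 (freeIn-approxMem m K m f τ a Ka (occursT-higherType m K τ))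

  star-cong-= : ∀ {n m} (t u : Term n) i (a b : Term m) → n ≤ s → m ≤ s → Dec (m ≡ n) →
                ⊢ (approx n t u `⊃ approx m (substT t i a) (substT t i b) `⊃ approx m (substT u i a) (substT u i b))
  star-cong-= {n} t u i a b n≤ m≤ (yes refl) =
    ⊃-intro₂ (⊩-mp₂ (≈-trans n _ _ _ n≤) (⊩-mp (⊢⇒⊩ wG (≈-sym n _ _ n≤)) (⊃-trans htu (≈-substT n t u i a n≤)))
                    (⊩-mp₂ (≈-trans n _ _ _ n≤) (⊩-premise₂ wtu wX) (⊃-trans htu (≈-substT n t u i b n≤))))
    where
    wtu = wf-approx n t u n≤
    wX = wf-approx n (substT t i a) (substT t i b) n≤
    wG = wX , (wtu , wf-⊤)
    htu = ⊩-premise₁ wtu wX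
  star-cong-= {n} {m} t u i a b n≤ m≤ (no m≢n) =
    cast⊢ (cong₂ (λ X Y → approx n t u `⊃ approx m X Y `⊃ approx m (substT u i a) (substT u i b)) (sym (substT-otherType t i a m≢n)) (sym (substT-otherType t i b m≢n)))
      (cast⊢ (cong₂ (λ X Y → approx n t u `⊃ approx m a b `⊃ approx m X Y) (sym (substT-otherType u i a m≢n)) (sym (substT-otherType u i b m≢n)))
        (⊢-ignore (wf-approx n t u n≤) (wf-approx m a b m≤)))

  star-cong-∈ : ∀ {n m} (t u : Term n) i (a : Term m) (τ : Term (suc m)) → n ≤ s → suc m ≤ s →
                Dec (m ≡ n) → Dec (suc m ≡ n) →
                ⊢ (approx n t u `⊃ star (substT t i a `∈ substT t i τ) `⊃ star (substT u i a `∈ substT u i τ))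
  star-cong-∈ {n} t u i a τ n≤ m≤ (yes refl) _ =
    cast⊢ (cong₂ (λ X Y → approx n t u `⊃ approxMem n (fresh (substT t i a)) X (substT t i a) `⊃ approxMem n (fresh (substT u i a)) Y (substT u i a))
            (sym (substT-otherType t i τ 1+n≢n)) (sym (substT-otherType u i τ 1+n≢n)))
      (⊃-trans (≈-substT n t u i a n≤)
               (approxMem-congˡ n (substT t i a) (substT u i a) τ _ _ m≤ (occursT-fresh n _ (substT t i a) ≤-refl) (occursT-fresh n _ (substT u i a) ≤-refl)))
  star-cong-∈ {.(suc m)} {m} t u i a τ n≤ m≤ (no _) (yes refl) =
    cast⊢ (cong₂ (λ X Y → approx (suc m) t u `⊃ approxMem m (fresh X) (substT t i τ) X `⊃ approxMem m (fresh Y) (substT u i τ) Y)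
            (sym (substT-otherType t i a n≢1+n)) (sym (substT-otherType u i a n≢1+n)))
      (⊃-trans (≈-substT (suc m) t u i τ n≤) (approxMem-congʳ m (substT t i τ) (substT u i τ) a (fresh a) m≤ (occursT-fresh m _ a ≤-refl)))
  star-cong-∈ {n} {m} t u i a τ n≤ m≤ (no m≢n) (no 1+m≢n) =
    cast⊢ (cong₂ (λ X Y → approx n t u `⊃ approxMem m (fresh X) Y X `⊃ star (substT u i a `∈ substT u i τ))
            (sym (substT-otherType t i a m≢n)) (sym (substT-otherType t i τ 1+m≢n)))
      (cast⊢ (cong₂ (λ X Y → approx n t u `⊃ approxMem m (fresh a) τ a `⊃ approxMem m (fresh X) Y X)
            (sym (substT-otherType u i a m≢n)) (sym (substT-otherType u i τ 1+m≢n)))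
        (⊢-ignore (wf-approx n t u n≤) (wf-approxMem m (fresh a) τ a m≤)))

  star-cong : ∀ {n} (t u : Term n) i φ → n ≤ s → Wf φ → FreeFor t i φ → FreeFor u i φ →
              ⊢ (approx n t u `⊃ star (subst t i φ) `⊃ star (subst u i φ))
  star-cong {n} t u i (_`=_ {m} a b) n≤ w ft fu = star-cong-= t u i a b n≤ w (m ≟ n)
  star-cong {n} t u i (_`∈_ {m} a τ) n≤ w ft fu = star-cong-∈ t u i a τ n≤ w (m ≟ n) (suc m ≟ n)
  star-cong {n} t u i `⊥ n≤ w ft fu = ⊢-ignore (wf-approx n t u n≤) tt
  star-cong t u i (φ `∧ ψ) n≤ (w₁ , w₂) (ft₁ , ft₂) (fu₁ , fu₂) =
    ∧-monoᴴ (star-cong t u i φ n≤ w₁ ft₁ fu₁) (star-cong t u i ψ n≤ w₂ ft₂ fu₂)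
  star-cong t u i (φ `∨ ψ) n≤ (w₁ , w₂) (ft₁ , ft₂) (fu₁ , fu₂) =
    ∨-monoᴴ (star-cong t u i φ n≤ w₁ ft₁ fu₁) (star-cong t u i ψ n≤ w₂ ft₂ fu₂)
  star-cong {n} t u i (φ `⊃ ψ) n≤ (w₁ , w₂) (ft₁ , ft₂) (fu₁ , fu₂) =
    ⊃-monoᴴ (⊃-trans (≈-sym n t u n≤) (star-cong u t i φ n≤ w₁ fu₁ ft₁)) (star-cong t u i ψ n≤ w₂ ft₂ fu₂)
  star-cong {n} t u i (`∀ m j φ) n≤ (m≤ , w) ft fu with compareVar m j n i
  ... | same refl refl =
    cast⊢ (cong₂ (λ X Y → approx n t u `⊃ star X `⊃ star Y) (sym (subst-∀-same t i n i φ (sameVar-refl n i))) (sym (subst-∀-same u i n i φ (sameVar-refl n i))))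
      (⊢-ignore (wf-approx n t u n≤) (m≤ , InL-star s φ w))
  ... | different e =
    cast⊢ (cong₂ (λ X Y → approx n t u `⊃ star X `⊃ star Y) (sym (subst-∀-other t i m j φ e)) (sym (subst-∀-other u i m j φ e)))
      (underBinder (freeFor-∀⁻ t i m j φ e ft) (freeFor-∀⁻ u i m j φ e fu))
    where
    FreeForUnder : Term n → Set
    FreeForUnder v = (freeIn n i φ ≡ false) ⊎ ((occursT m j v ≡ false) × FreeFor v i φ)
    underBinder : FreeForUnder t → FreeForUnder u → ⊢ (approx n t u `⊃ `∀ m j (star (subst t i φ)) `⊃ `∀ m j (star (subst u i φ)))
    underBinder (inj₂ (jt , ft′)) (inj₂ (ju , fu′)) = ∀-monoᴴ m j m≤ (freeIn-approx-false m j n t u jt ju) (star-cong t u i φ n≤ w ft′ fu′)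
    underBinder (inj₁ nf) _ =
      cast⊢ (cong₂ (λ X Y → approx n t u `⊃ `∀ m j (star X) `⊃ `∀ m j (star Y)) (sym (subst-notFree t i φ nf)) (sym (subst-notFree u i φ nf)))
        (⊢-ignore (wf-approx n t u n≤) (m≤ , InL-star s φ w))
    underBinder (inj₂ _) (inj₁ nf) = underBinder (inj₁ nf) (inj₁ nf)
  star-cong {n} t u i (`∃ m j φ) n≤ (m≤ , w) ft fu with compareVar m j n i
  ... | same refl refl =
    cast⊢ (cong₂ (λ X Y → approx n t u `⊃ star X `⊃ star Y) (sym (subst-∃-same t i n i φ (sameVar-refl n i))) (sym (subst-∃-same u i n i φ (sameVar-refl n i))))
      (⊢-ignore (wf-approx n t u n≤) (m≤ , InL-star s φ w))
  ... | different e =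
    cast⊢ (cong₂ (λ X Y → approx n t u `⊃ star X `⊃ star Y) (sym (subst-∃-other t i m j φ e)) (sym (subst-∃-other u i m j φ e)))
      (underBinder (freeFor-∃⁻ t i m j φ e ft) (freeFor-∃⁻ u i m j φ e fu))
    where
    FreeForUnder : Term n → Set
    FreeForUnder v = (freeIn n i φ ≡ false) ⊎ ((occursT m j v ≡ false) × FreeFor v i φ)
    underBinder : FreeForUnder t → FreeForUnder u → ⊢ (approx n t u `⊃ `∃ m j (star (subst t i φ)) `⊃ `∃ m j (star (subst u i φ)))
    underBinder (inj₂ (jt , ft′)) (inj₂ (ju , fu′)) = ∃-monoᴴ m j m≤ (freeIn-approx-false m j n t u jt ju) (star-cong t u i φ n≤ w ft′ fu′)
    underBinder (inj₁ nf) _ =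
      cast⊢ (cong₂ (λ X Y → approx n t u `⊃ `∃ m j (star X) `⊃ `∃ m j (star Y)) (sym (subst-notFree t i φ nf)) (sym (subst-notFree u i φ nf)))
        (⊢-ignore (wf-approx n t u n≤) (m≤ , InL-star s φ w))
    underBinder (inj₂ _) (inj₁ nf) = underBinder (inj₁ nf) (inj₁ nf)

  approxMem-rename : ∀ m (a : Term m) (τ : Term (suc m)) f g → suc m ≤ s → occursT m f a ≡ false → occursT m g a ≡ false →
                     approxMem m f τ a ⟺ approxMem m g τ a
  approxMem-rename m a τ f g p fa ga = mp (approxMem-congˡ m a a τ f g p fa ga) (≈-refl m a (<⇒≤ p))
                                     , mp (approxMem-congˡ m a a τ g f p ga fa) (≈-refl m a (<⇒≤ p))

  subst-star : ∀ {n} (t : Term n) i φ → Wf φ → FreeFor t i (star φ) → FreeFor t i φ → subst t i (star φ) ⟺ star (subst t i φ)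
  subst-star t i (_`=_ {m} a b) w fs f = ⟺-cast (sym (approx-subst t i m a b)) refl (⟺-refl (wf-approx m _ _ w))
  subst-star {n} t i (_`∈_ {m} a τ) w fs f with compareVar m (fresh a) n i
  ... | same refl refl = ⟺-cast (sym (subst-∃-same t (fresh a) m (fresh a) _ (sameVar-refl m (fresh a))))
                           (cong₂ (λ X Y → star (X `∈ Y)) (sym (substT-notOccurring t (fresh a) a (occursT-fresh m (fresh a) a ≤-refl)))
                                                          (sym (substT-otherType t (fresh a) τ 1+n≢n)))
                           (⟺-refl (wf-approxMem m (fresh a) τ a w))
  ... | different e = ⟺-cast (sym (approxMem-subst t i m f₀ τ a e)) refl
                        (approxMem-rename m (substT t i a) (substT t i τ) f₀ (fresh (substT t i a)) w f₀∉a[t] (occursT-fresh m _ (substT t i a) ≤-refl))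
    where
    f₀ = fresh a
    f₀∉a[t] : occursT m f₀ (substT t i a) ≡ false
    f₀∉a[t] with freeFor-∃⁻ t i m f₀ ((var m f₀ `∈ τ) `∧ approx m (var m f₀) a) e fs
    ... | inj₁ nf = let i∉a = proj₂ (∨-false⁻ (trans (sym (freeIn-approx n i m (var m f₀) a)) (proj₂ (∨-false⁻ {occursT n i (var m f₀) ∨ occursT n i τ} nf)))) in
                    trans (cong (occursT m f₀) (substT-notOccurring t i a i∉a)) (occursT-fresh m f₀ a ≤-refl)
    ... | inj₂ (f₀∉t , _) = occursT-substT m f₀ t i a (occursT-fresh m f₀ a ≤-refl) f₀∉t
  subst-star t i `⊥ w fs f = ⟺-refl tt
  subst-star t i (φ `∧ ψ) (w₁ , w₂) (fs₁ , fs₂) (f₁ , f₂) = ∧-cong (subst-star t i φ w₁ fs₁ f₁) (subst-star t i ψ w₂ fs₂ f₂)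
  subst-star t i (φ `∨ ψ) (w₁ , w₂) (fs₁ , fs₂) (f₁ , f₂) = ∨-cong (subst-star t i φ w₁ fs₁ f₁) (subst-star t i ψ w₂ fs₂ f₂)
  subst-star t i (φ `⊃ ψ) (w₁ , w₂) (fs₁ , fs₂) (f₁ , f₂) = ⊃-cong (subst-star t i φ w₁ fs₁ f₁) (subst-star t i ψ w₂ fs₂ f₂)
  subst-star {n} t i (`∀ m j ψ) (m≤ , wψ) fs f with compareVar m j n i
  ... | same refl refl = ⟺-cast (sym (subst-∀-same t i n i (star ψ) (sameVar-refl n i))) (cong star (sym (subst-∀-same t i n i ψ (sameVar-refl n i))))
                           (⟺-refl (m≤ , InL-star s ψ wψ))
  ... | different e = ⟺-cast (sym (subst-∀-other t i m j (star ψ) e)) (cong star (sym (subst-∀-other t i m j ψ e)))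
                        (underBinder (freeFor-∀⁻ t i m j (star ψ) e fs) (freeFor-∀⁻ t i m j ψ e f))
    where
    underBinder : (freeIn n i (star ψ) ≡ false) ⊎ ((occursT m j t ≡ false) × FreeFor t i (star ψ)) →
                  (freeIn n i ψ ≡ false) ⊎ ((occursT m j t ≡ false) × FreeFor t i ψ) →
                  `∀ m j (subst t i (star ψ)) ⟺ `∀ m j (star (subst t i ψ))
    underBinder (inj₂ (_ , fs′)) (inj₂ (_ , f′)) = ∀-cong m j m≤ (subst-star t i ψ wψ fs′ f′)
    underBinder _ (inj₁ nf) =
      ⟺-cast (cong (`∀ m j) (sym (subst-notFree t i (star ψ) (trans (freeIn-star n i ψ) nf))))
             (cong (λ X → `∀ m j (star X)) (sym (subst-notFree t i ψ nf))) (⟺-refl (m≤ , InL-star s ψ wψ))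
    underBinder (inj₁ nfs) (inj₂ _) = underBinder (inj₁ nfs) (inj₁ (trans (sym (freeIn-star n i ψ)) nfs))
  subst-star {n} t i (`∃ m j ψ) (m≤ , wψ) fs f with compareVar m j n i
  ... | same refl refl = ⟺-cast (sym (subst-∃-same t i n i (star ψ) (sameVar-refl n i))) (cong star (sym (subst-∃-same t i n i ψ (sameVar-refl n i))))
                           (⟺-refl (m≤ , InL-star s ψ wψ))
  ... | different e = ⟺-cast (sym (subst-∃-other t i m j (star ψ) e)) (cong star (sym (subst-∃-other t i m j ψ e)))
                        (underBinder (freeFor-∃⁻ t i m j (star ψ) e fs) (freeFor-∃⁻ t i m j ψ e f))
    where
    underBinder : (freeIn n i (star ψ) ≡ false) ⊎ ((occursT m j t ≡ false) × FreeFor t i (star ψ)) →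
                  (freeIn n i ψ ≡ false) ⊎ ((occursT m j t ≡ false) × FreeFor t i ψ) →
                  `∃ m j (subst t i (star ψ)) ⟺ `∃ m j (star (subst t i ψ))
    underBinder (inj₂ (_ , fs′)) (inj₂ (_ , f′)) = ∃-cong m j m≤ (subst-star t i ψ wψ fs′ f′)
    underBinder _ (inj₁ nf) =
      ⟺-cast (cong (`∃ m j) (sym (subst-notFree t i (star ψ) (trans (freeIn-star n i ψ) nf))))
             (cong (λ X → `∃ m j (star X)) (sym (subst-notFree t i ψ nf))) (⟺-refl (m≤ , InL-star s ψ wψ))
    underBinder (inj₁ nfs) (inj₂ _) = underBinder (inj₁ nfs) (inj₁ (trans (sym (freeIn-star n i ψ)) nfs))

  -- FreeFor t i φ does not give FreeFor t i (star φ), because star adds binders. So both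
  -- axioms pass through a variable z beyond every index of φ and t: z is free for
  -- everything, subst-star applies to it, and star-cong moves between z and t since
  -- ∃z (z ≈ t) holds by ≈-refl.
  module ThroughFreshVariable {n} (t : Term n) (φ : Form) where
    K : ℕ
    K = suc (suc (indexBound φ ⊔ fresh t))

    z : Term n
    z = var n K

    φ<K : indexBound φ ≤ K
    φ<K = ≤-trans (m≤m⊔n (indexBound φ) (fresh t)) (≤-trans (n≤1+n _) (n≤1+n _))

    K∉t : occursT n K t ≡ false
    K∉t = occursT-fresh n K t (≤-trans (m≤n⊔m (indexBound φ) (fresh t)) (≤-trans (n≤1+n _) (n≤1+n _)))

    K∉φ : freeIn n K φ ≡ false
    K∉φ = freeIn-indexBound n K φ φ<K

    z-freeFor-star : ∀ i → FreeFor z i (star φ)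
    z-freeFor-star i = freeFor-var-binderBound n K i (star φ) (binderBound-star K φ (s≤s (s≤s z≤n)) φ<K)

    z-freeFor : ∀ i → FreeFor z i φ
    z-freeFor i = freeFor-var-binderBound n K i φ (≤-trans (binderBound≤indexBound φ) φ<K)

    ∃z≈t : n ≤ s → ⊢ `∃ n K (approx n z t)
    ∃z≈t n≤ = ⊤⊩⇒⊢ (∃-intro t n≤ (freeFor-approx t K n z t ≤-refl) (cast⊢ (cong (`⊤ `⊃_) (sym e)) (⊢⇒⊤⊩ (≈-refl n t n≤))))
      where
      e : subst t K (approx n z t) ≡ approx n t t
      e rewrite approx-subst t K n z t | substT-var-same t K | substT-notOccurring t K t K∉t = refl

    ∃t≈z : n ≤ s → ⊢ `∃ n K (approx n t z)
    ∃t≈z n≤ = ⊤⊩⇒⊢ (∃-intro t n≤ (freeFor-approx t K n t z ≤-refl) (cast⊢ (cong (`⊤ `⊃_) (sym e)) (⊢⇒⊤⊩ (≈-refl n t n≤))))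
      where
      e : subst t K (approx n t z) ≡ approx n t t
      e rewrite approx-subst t K n t z | substT-var-same t K | substT-notOccurring t K t K∉t = refl

  ∀-elim-star : ∀ {n} (t : Term n) i φ → n ≤ s → Wf φ → FreeFor t i φ → ⊢ (`∀ n i (star φ) `⊃ star (subst t i φ))
  ∀-elim-star {n} t i φ n≤ w ft = ⊃-intro⊤ (∃-elim (⊢⇒⊩ wG (∃z≈t n≤)) fromZ frG frC)
    where
    open ThroughFreshVariable t φ
    G = `∀ n i (star φ) `∧ `⊤
    wG : Wf G
    wG = (n≤ , InL-star s φ w) , wf-⊤
    φ[z] = subst z i φ
    atZ : G ⊩ star φ[z]
    atZ = ⊃-trans (∀-elim z (z-freeFor-star i) (⊩-head (n≤ , InL-star s φ w) wf-⊤)) (proj₁ (subst-star z i φ w (z-freeFor-star i) (z-freeFor i)))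
    A = approx n z t
    wA = wf-approx n z t n≤
    fromZ : (A `∧ G) ⊩ star (subst t i φ)
    fromZ = cast⊢ (cong (λ X → (A `∧ G) `⊃ star X) (subst-renamed t K i φ φ<K))
              (⊩-mp₂ (star-cong z t K φ[z] n≤ (InL-subst⁺ s z i φ w) (freeFor-self n K φ[z]) (freeFor-renamed t K i φ ft φ<K))
                     (⊩-head wA wG)
                     (cast⊢ (cong (λ X → (A `∧ G) `⊃ star X) (sym (subst-id n K φ[z]))) (⊩-weaken wA atZ)))
    frG : freeIn n K G ≡ false
    frG = ∨-false⁺ (freeIn-∀-false n K n i (star φ) (trans (freeIn-star n K φ) K∉φ)) refl
    frC : freeIn n K (star (subst t i φ)) ≡ false
    frC = trans (freeIn-star n K (subst t i φ)) (freeIn-subst n K t i φ K∉φ K∉t)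

  ∃-intro-star : ∀ {n} (t : Term n) i φ → n ≤ s → Wf φ → FreeFor t i φ → ⊢ (star (subst t i φ) `⊃ `∃ n i (star φ))
  ∃-intro-star {n} t i φ n≤ w ft = ⊃-intro⊤ (∃-elim (⊢⇒⊩ wG (∃t≈z n≤)) toZ frG frC)
    where
    open ThroughFreshVariable t φ
    wφ[t] = InL-star s (subst t i φ) (InL-subst⁺ s t i φ w)
    G = star (subst t i φ) `∧ `⊤
    wG : Wf G
    wG = wφ[t] , wf-⊤
    φ[z] = subst z i φ
    A = approx n t z
    wA = wf-approx n t z n≤
    atZ : (A `∧ G) ⊩ star φ[z]
    atZ = cast⊢ (cong (λ X → (A `∧ G) `⊃ star X) (subst-id n K φ[z]))
            (⊩-mp₂ (star-cong t z K φ[z] n≤ (InL-subst⁺ s z i φ w) (freeFor-renamed t K i φ ft φ<K) (freeFor-self n K φ[z]))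
                   (⊩-head wA wG)
                   (cast⊢ (cong (λ X → (A `∧ G) `⊃ star X) (sym (subst-renamed t K i φ φ<K))) (⊩-weaken wA (⊩-head wφ[t] wf-⊤))))
    toZ : (A `∧ G) ⊩ `∃ n i (star φ)
    toZ = ∃-intro z n≤ (z-freeFor-star i) (⊃-trans atZ (proj₂ (subst-star z i φ w (z-freeFor-star i) (z-freeFor i))))
    frG : freeIn n K G ≡ false
    frG = ∨-false⁺ (trans (freeIn-star n K (subst t i φ)) (freeIn-subst n K t i φ K∉φ K∉t)) refl
    frC : freeIn n K (`∃ n i (star φ)) ≡ false
    frC = freeIn-∃-false n K n i (star φ) (trans (freeIn-star n K φ) K∉φ)

  LogAx-star : ∀ {φ} → LogAx φ → Wf φ → ⊢ star φ
  LogAx-star (axK φ ψ) w = lax (axK (star φ) (star ψ)) (InL-star s (φ `⊃ ψ `⊃ φ) w)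
  LogAx-star (axS φ ψ χ) w = lax (axS (star φ) (star ψ) (star χ)) (InL-star s ((φ `⊃ ψ `⊃ χ) `⊃ (φ `⊃ ψ) `⊃ φ `⊃ χ) w)
  LogAx-star (∧I φ ψ) w = lax (∧I (star φ) (star ψ)) (InL-star s (φ `⊃ ψ `⊃ (φ `∧ ψ)) w)
  LogAx-star (∧E₁ φ ψ) w = lax (∧E₁ (star φ) (star ψ)) (InL-star s ((φ `∧ ψ) `⊃ φ) w)
  LogAx-star (∧E₂ φ ψ) w = lax (∧E₂ (star φ) (star ψ)) (InL-star s ((φ `∧ ψ) `⊃ ψ) w)
  LogAx-star (∨I₁ φ ψ) w = lax (∨I₁ (star φ) (star ψ)) (InL-star s (φ `⊃ (φ `∨ ψ)) w)
  LogAx-star (∨I₂ φ ψ) w = lax (∨I₂ (star φ) (star ψ)) (InL-star s (ψ `⊃ (φ `∨ ψ)) w)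
  LogAx-star (∨E φ ψ χ) w = lax (∨E (star φ) (star ψ) (star χ)) (InL-star s ((φ `⊃ χ) `⊃ (ψ `⊃ χ) `⊃ (φ `∨ ψ) `⊃ χ) w)
  LogAx-star (⊥E φ) w = lax (⊥E (star φ)) (InL-star s (`⊥ `⊃ φ) w)
  LogAx-star (dne φ) w = lax (dne (star φ)) (InL-star s (`¬ `¬ φ `⊃ φ) w)
  LogAx-star (∀E i φ t f) ((n≤ , wφ) , _) = ∀-elim-star t i φ n≤ wφ f
  LogAx-star (∃I i φ t f) (_ , (n≤ , wφ)) = ∃-intro-star t i φ n≤ wφ f
  LogAx-star (=refl {n} t) w = ≈-refl n t w
  LogAx-star (=subst {n} i φ t u ft fu) (n≤ , (wt , _)) = star-cong t u i φ n≤ (InL-subst⁻ s t i φ wt) ft fu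

module TI*-Axioms (s : ℕ) where
  open Approximation s (TIAx false) public

  approxIncl-ext : ∀ n k (a b : Term (suc n)) → suc n ≤ s →
                   ⊢ (`∀ n k (approxMem n (suc k) a (var n k) `⊃ approxMem n (suc k) b (var n k)) `⊃ approxIncl n a b)
  approxIncl-ext n k a b p = ⊃-intro⊤ (∀-intro q (∨-false⁺ (H-closed k) refl) (⊃-intro (∃-elim memB inner frG frC)))
    where
    q = <⇒≤ p
    v0 = var n 0
    vk = var n k
    w = var n (suc k)
    H = `∀ n k (approxMem n (suc k) a vk `⊃ approxMem n (suc k) b vk)
    wH : Wf H
    wH = q , (wf-approxMem n (suc k) a vk p , wf-approxMem n (suc k) b vk p)
    H-closed : ∀ k → freeIn n 0 (`∀ n k (approxMem n (suc k) a (var n k) `⊃ approxMem n (suc k) b (var n k))) ≡ false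
    H-closed zero = freeIn-∀-self n 0 (approxMem n 1 a v0 `⊃ approxMem n 1 b v0)
    H-closed (suc k) = freeIn-∀-false n 0 n (suc k) (approxMem n (suc (suc k)) a (var n (suc k)) `⊃ approxMem n (suc (suc k)) b (var n (suc k)))
      (∨-false⁺ (freeIn-approxMem n 0 n (suc (suc k)) a (var n (suc k)) (occursT-var-other n 0 (suc k) (λ ())) (occursT-higherType n 0 a))
                (freeIn-approxMem n 0 n (suc (suc k)) b (var n (suc k)) (occursT-var-other n 0 (suc k) (λ ())) (occursT-higherType n 0 b)))
    G = (v0 `∈ a) `∧ (H `∧ `⊤)
    wG : Wf G
    wG = p , (wH , wf-⊤)
    e : subst v0 k (approxMem n (suc k) a vk `⊃ approxMem n (suc k) b vk) ≡ (approxMem n (suc k) a v0 `⊃ approxMem n (suc k) b v0)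
    e rewrite approxMem-subst v0 k n (suc k) a vk (sameVar-false-index {n} {suc k} {n} {k} 1+n≢n)
            | approxMem-subst v0 k n (suc k) b vk (sameVar-false-index {n} {suc k} {n} {k} 1+n≢n)
            | substT-otherType v0 k a 1+n≢n | substT-otherType v0 k b 1+n≢n | substT-var-same v0 k = refl
    memB : G ⊩ approxMem n (suc k) b v0
    memB = ⊩-mp (cast⊢ (cong (G `⊃_) e)
                   (∀-elim v0 (freeFor-approxMem v0 k n (suc k) a vk ≤-refl (occursT-var-other n (suc k) 0 (λ ()))
                              , freeFor-approxMem v0 k n (suc k) b vk ≤-refl (occursT-var-other n (suc k) 0 (λ ())))
                           (⊩-weaken p (⊩-head wH wf-⊤))))
                (⊃-trans (⊩-head p (wH , wf-⊤)) (∈⇒approxMem n (suc k) a 0 (λ ()) p))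
    B = (w `∈ b) `∧ approx n w v0
    wB : Wf B
    wB = p , wf-approx n w v0 q
    eB : subst w 1 ((var n 1 `∈ b) `∧ approx n v0 (var n 1)) ≡ ((w `∈ b) `∧ approx n v0 w)
    eB rewrite substT-var-same w 1 | substT-otherType w 1 b 1+n≢n | approx-subst w 1 n v0 (var n 1) | substT-var-same w 1 | substT-var-other w 1 0 (λ ()) = refl
    inner : (B `∧ G) ⊩ `∃ n 1 (approxInclWitness n b)
    inner = ∃-intro w q (tt , freeFor-approx w 1 n v0 (var n 1) ≤-refl) (cast⊢ (cong ((B `∧ G) `⊃_) (sym eB))
              (∧-intro (∧-elimˡ (⊩-head wB wG)) (⊃-trans (∧-elimʳ (⊩-head wB wG)) (≈-sym n w v0 q))))
    frG : freeIn n (suc k) G ≡ false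
    frG = ∨-false⁺ (∨-false⁺ (occursT-var-other n (suc k) 0 (λ ())) (occursT-higherType n (suc k) a))
                   (∨-false⁺ (freeIn-∀-false n (suc k) n k (approxMem n (suc k) a vk `⊃ approxMem n (suc k) b vk) (∨-false⁺ (freeIn-∃-self n (suc k) ((w `∈ a) `∧ approx n w vk))
                                                                      (freeIn-∃-self n (suc k) ((w `∈ b) `∧ approx n w vk)))) refl)
    frC : freeIn n (suc k) (`∃ n 1 (approxInclWitness n b)) ≡ false
    frC = freeIn-∃approxInclWitness n (suc k) b (λ ())

  ext-star : ∀ n i j k → suc n ≤ s →
    ⊢ star (`∀ n k ((var n k `∈ var (suc n) i) `⇔ (var n k `∈ var (suc n) j)) `⊃ var (suc n) i `= var (suc n) j)
  ext-star n i j k p = ⊃-intro⊤ (∧-intro (⊃-trans (⊃-trans hH (∀-mono n k q (lax (∧E₁ (Mi `⊃ Mj) (Mj `⊃ Mi)) (wE , wij)))) (approxIncl-ext n k xi xj p))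
                                         (⊃-trans (⊃-trans hH (∀-mono n k q (lax (∧E₂ (Mi `⊃ Mj) (Mj `⊃ Mi)) (wE , wji)))) (approxIncl-ext n k xj xi p)))
    where
    q = <⇒≤ p
    xi = var (suc n) i
    xj = var (suc n) j
    Mi = approxMem n (suc k) xi (var n k)
    Mj = approxMem n (suc k) xj (var n k)
    wij = wf-approxMem n (suc k) xi (var n k) p , wf-approxMem n (suc k) xj (var n k) p
    wji = wf-approxMem n (suc k) xj (var n k) p , wf-approxMem n (suc k) xi (var n k) p
    wE = wij , wji
    hH = ⊩-head (q , wE) wf-⊤

  comp-star-member : ∀ n j (x : Term (suc n)) φ → suc n ≤ s → Wf φ →
    ⊢ (`∀ n j (((var n j `∈ x) `⊃ star φ) `∧ (star φ `⊃ (var n j `∈ x))) `⊃ star φ `⊃ approxMem n (suc j) x (var n j))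
  comp-star-member n j x φ p wφ =
    ⊃-intro₂ (⊃-trans (⊩-mp (∧-elimʳ (∀-elim-self (⊩-premise₁ wH wS))) (⊩-premise₂ wH wS))
                      (∈⇒approxMem n (suc j) x j 1+n≢n p))
    where
    wS = InL-star s φ wφ
    wH = <⇒≤ p , ((p , wS) , (wS , p))

  -- The set that comprehension provides for star φ is closed under ≈ because star φ is (star-cong).
  comp-star-closed : ∀ n j (x : Term (suc n)) φ → suc n ≤ s → Wf φ →
    ⊢ (`∀ n j (((var n j `∈ x) `⊃ star φ) `∧ (star φ `⊃ (var n j `∈ x))) `⊃ approxMem n (suc j) x (var n j) `⊃ star φ)
  comp-star-closed n j x φ p wφ = ⊃-intro₂ (∃-elim memberK fromY frG1 frSφ)
    where
    q = <⇒≤ p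
    z = var n j
    Sφ = star φ
    wS = InL-star s φ wφ
    E = ((z `∈ x) `⊃ Sφ) `∧ (Sφ `⊃ (z `∈ x))
    wH : Wf (`∀ n j E)
    wH = q , ((p , wS) , (wS , p))
    M = approxMem n (suc j) x z
    wM = wf-approxMem n (suc j) x z p
    G1 = M `∧ (`∀ n j E `∧ `⊤)
    wG1 = wM , (wH , wf-⊤)
    K = suc (suc (indexBound φ ⊔ suc j))
    y = var n K
    φ<K : indexBound φ ≤ K
    φ<K = ≤-trans (m≤m⊔n (indexBound φ) (suc j)) (≤-trans (n≤1+n _) (n≤1+n _))
    K∉z : occursT n K z ≡ false
    K∉z = occursT-var-other n K j (<⇒≢ (≤-trans (m≤n⊔m (indexBound φ) (suc j)) (≤-trans (n≤1+n _) (n≤1+n _))))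
    memberK : G1 ⊩ approxMem n K x z
    memberK = ⊃-trans (⊩-premise₂ wH wM) (proj₁ (approxMem-rename n z x (suc j) K p (occursT-var-other n (suc j) j n≢1+n) K∉z))
    Y = (y `∈ x) `∧ approx n y z
    wY : Wf Y
    wY = p , wf-approx n y z q
    G2 = Y `∧ G1
    y-freeFor-star : FreeFor y j Sφ
    y-freeFor-star = freeFor-var-binderBound n K j Sφ (binderBound-star K φ (s≤s (s≤s z≤n)) φ<K)
    eE : subst y j E ≡ (((y `∈ x) `⊃ subst y j Sφ) `∧ (subst y j Sφ `⊃ (y `∈ x)))
    eE rewrite substT-var-same y j | substT-otherType y j x 1+n≢n = refl
    E[y] : G2 ⊩ (((y `∈ x) `⊃ subst y j Sφ) `∧ (subst y j Sφ `⊃ (y `∈ x)))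
    E[y] = cast⊢ (cong (G2 `⊃_) eE) (∀-elim y ((tt , y-freeFor-star) , (y-freeFor-star , tt)) (⊩-weaken wY (⊩-premise₁ wH wM)))
    φ[y] = subst y j φ
    atY : G2 ⊩ star φ[y]
    atY = ⊃-trans (⊩-mp (∧-elimˡ E[y]) (∧-elimˡ (⊩-head wY wG1)))
                  (proj₁ (subst-star y j φ wφ y-freeFor-star (freeFor-var-binderBound n K j φ (≤-trans (binderBound≤indexBound φ) φ<K))))
    fromY : G2 ⊩ Sφ
    fromY = cast⊢ (cong (λ X → G2 `⊃ star X) (trans (subst-renamed z K j φ φ<K) (subst-id n j φ)))
              (⊩-mp₂ (star-cong y z K φ[y] q (InL-subst⁺ s y j φ wφ) (freeFor-self n K φ[y]) (freeFor-renamed z K j φ (freeFor-self n j φ) φ<K))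
                     (∧-elimʳ (⊩-head wY wG1))
                     (cast⊢ (cong (λ X → G2 `⊃ star X) (sym (subst-id n K φ[y]))) atY))
    frSφ : freeIn n K Sφ ≡ false
    frSφ = trans (freeIn-star n K φ) (freeIn-indexBound n K φ φ<K)
    frG1 : freeIn n K G1 ≡ false
    frG1 = ∨-false⁺ (freeIn-approxMem n K n (suc j) x z K∉z (occursT-higherType n K x))
             (∨-false⁺ (freeIn-∀-false n K n j E (∨-false⁺ (∨-false⁺ (∨-false⁺ K∉z (occursT-higherType n K x)) frSφ)
                                                            (∨-false⁺ frSφ (∨-false⁺ K∉z (occursT-higherType n K x))))) refl)

  comp-star : ∀ n i j φ → freeIn (suc n) i φ ≡ false → (∀ m k → freeIn m k φ ≡ true → m ≤ suc n) → suc n ≤ s → Wf φ →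
    ⊢ star (`∃ (suc n) i (`∀ n j ((var n j `∈ var (suc n) i) `⇔ φ)))
  comp-star n i j φ fr fm p wφ = mp (∃-mono (suc n) i p (⊃-intro⊤ (∀-intro (<⇒≤ p) (∨-false⁺ (freeIn-∀-self n j E) refl) bothWays)))
                                    (ax (comp n i j (star φ) fr* fm*) (p , (<⇒≤ p , ((p , wS) , (wS , p)))))
    where
    x = var (suc n) i
    wS = InL-star s φ wφ
    E = ((var n j `∈ x) `⊃ star φ) `∧ (star φ `⊃ (var n j `∈ x))
    hH : (`∀ n j E `∧ `⊤) ⊩ `∀ n j E
    hH = ⊩-head (<⇒≤ p , ((p , wS) , (wS , p))) wf-⊤
    bothWays : (`∀ n j E `∧ `⊤) ⊩ ((approxMem n (suc j) x (var n j) `⊃ star φ) `∧ (star φ `⊃ approxMem n (suc j) x (var n j)))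
    bothWays = ∧-intro (⊃-trans hH (comp-star-closed n j x φ p wφ)) (⊃-trans hH (comp-star-member n j x φ p wφ))
    fr* : freeIn (suc n) i (star φ) ≡ false
    fr* = trans (freeIn-star (suc n) i φ) fr
    fm* : ∀ m k → freeIn m k (star φ) ≡ true → m ≤ suc n
    fm* m k e = fm m k (trans (sym (freeIn-star m k φ)) e)

  ind-star : ∀ i φ → Wf φ →
    ⊢ star ((subst `0 i φ `∧ `∀ 0 i (φ `⊃ subst (`S (var 0 i)) i φ)) `⊃ `∀ 0 i φ)
  ind-star i φ wφ = ⊃-trans (∧-mono (proj₂ at0) (∀-mono 0 i z≤n (⊃-mono (⊢-id wS) (proj₂ atS))))
                            (ax (ind i (star φ)) ((InL-subst⁺ s `0 i (star φ) wS , (z≤n , (wS , InL-subst⁺ s (`S (var 0 i)) i (star φ) wS))) , (z≤n , wS)))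
    where
    wS = InL-star s φ wφ
    0-closed : ∀ m j → sameVar m j 0 i ≡ false → occursT m j `0 ≡ false
    0-closed m j e = refl
    Si-onlyVar : ∀ m j → sameVar m j 0 i ≡ false → occursT m j (`S (var 0 i)) ≡ false
    Si-onlyVar m j e = trans (sameVar-sym 0 i m j) e
    at0 = subst-star `0 i φ wφ (freeFor-onlyVar `0 i (star φ) 0-closed) (freeFor-onlyVar `0 i φ 0-closed)
    atS = subst-star (`S (var 0 i)) i φ wφ (freeFor-onlyVar (`S (var 0 i)) i (star φ) Si-onlyVar) (freeFor-onlyVar (`S (var 0 i)) i φ Si-onlyVar)

  TIAx-star : ∀ {φ} → TIAx true φ → Wf φ → ⊢ star φ
  TIAx-star pa1 w = ax pa1 w
  TIAx-star pa2 w = ax pa2 w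
  TIAx-star pa3 w = ax pa3 w
  TIAx-star pa4 w = ax pa4 w
  TIAx-star pa5 w = ax pa5 w
  TIAx-star pa6 w = ax pa6 w
  TIAx-star (ind i φ) w = ind-star i φ (proj₂ (proj₂ w))
  TIAx-star (comp n i j φ fr fm) w = comp-star n i j φ fr fm (proj₁ w) (proj₂ (proj₁ (proj₂ (proj₂ w))))
  TIAx-star (ext _ n i j k) w = ext-star n i j k (proj₂ w)

  star-sound : ∀ {φ} → TI⊢ s φ → ⊢ star φ
  star-sound (ax a w) = TIAx-star a w
  star-sound (lax l w) = LogAx-star l w
  star-sound (mp p q) = mp (star-sound p) (star-sound q)
  star-sound (∀R {φ} {ψ} {n} {i} n≤ f p) = ∀R n≤ (trans (freeIn-star n i ψ) f) (star-sound p)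
  star-sound (∃L {φ} {ψ} {n} {i} n≤ f p) = ∃L n≤ (trans (freeIn-star n i ψ) f) (star-sound p)

closeOver : List (ℕ × ℕ) → Form → Form
closeOver L φ = foldr (λ { (n , i) ψ → `∀ n i ψ }) φ L

star-closeOver : ∀ L φ → star (closeOver L φ) ≡ closeOver L (star φ)
star-closeOver [] φ = refl
star-closeOver ((n , i) ∷ L) φ = cong (`∀ n i) (star-closeOver L φ)

TypeBelow : ℕ → ℕ × ℕ → Set
TypeBelow s (n , i) = n ≤ s

All-varsT : ∀ s {m} (t : Term m) → m ≤ s → All (TypeBelow s) (varsT t)
All-varsT s (var m j) p = p ∷ []
All-varsT s `0 p = []
All-varsT s (`S t) p = All-varsT s t p
All-varsT s (t `+ u) p = ++⁺ (All-varsT s t p) (All-varsT s u p)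
All-varsT s (t `· u) p = ++⁺ (All-varsT s t p) (All-varsT s u p)

-- At binders fvs uses filterᵇ p, which unfolds to filter (T? ∘ p).
All-fvs : ∀ s φ → InL s φ → All (TypeBelow s) (fvs φ)
All-fvs s (t `= u) w = ++⁺ (All-varsT s t w) (All-varsT s u w)
All-fvs s (t `∈ u) w = ++⁺ (All-varsT s t (<⇒≤ w)) (All-varsT s u w)
All-fvs s `⊥ w = []
All-fvs s (φ `∧ ψ) (a , b) = ++⁺ (All-fvs s φ a) (All-fvs s ψ b)
All-fvs s (φ `∨ ψ) (a , b) = ++⁺ (All-fvs s φ a) (All-fvs s ψ b)
All-fvs s (φ `⊃ ψ) (a , b) = ++⁺ (All-fvs s φ a) (All-fvs s ψ b)
All-fvs s (`∀ m j φ) (a , b) = filter⁺ (T? ∘ _) (All-fvs s φ b)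
All-fvs s (`∃ m j φ) (a , b) = filter⁺ (T? ∘ _) (All-fvs s φ b)

closeOver-intro : ∀ s {Γ} L φ → All (TypeBelow s) L → Prov s Γ φ → Prov s Γ (closeOver L φ)
closeOver-intro s [] φ _ p = p
closeOver-intro s ((n , i) ∷ L) φ (n≤ ∷ below) p =
  let open NaturalDeduction s _ in ⊤⊩⇒⊢ (∀-intro n≤ refl (⊢⇒⊤⊩ (closeOver-intro s L φ below p)))

lemma12p1 : (s : ℕ) (φ : Form) → InL s φ → TI⊢ s φ → TI*⊢ s (star (closure φ))
lemma12p1 s φ w p =
  let open TI*-Axioms s in
  cast⊢ (sym (star-closeOver (fvs φ) φ)) (closeOver-intro s (fvs φ) (star φ) (All-fvs s φ w) (star-sound p))
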